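{- There is no linear code $C\subseteq\mathbb{F}_5^{13}$ that is a completely regular code in the Hamming graph $H(13,5)$ with intersection array $\{52,42,16;1,6,28\}$.
   Context: The Hamming graph $H(n,q)$ has vertex set $\mathbb{F}_q^n$, two vectors adjacent iff they differ in exactly one coordinate. For a set of vertices $C$, let $C^{(k)}$ be the set of vertices at distance exactly $k$ from $C$, and $\rho$ the largest $k$ with $C^{(k)}\neq\emptyset$. $C$ is a completely regular code if each vertex in $C^{(k)}$ has a number of neighbors in each $C^{(l)}$ depending only on $k,l$, vanishing for $|k-l|>1$; its intersection array is $\{\beta_0,\ldots,\beta_{\rho-1};\gamma_1,\ldots,\gamma_\rho\}$, where $\beta_k$ (resp. $\gamma_k$) is the number of neighbors in $C^{(k+1)}$ (resp. $C^{(k-1)}$) of any vertex in $C^{(k)}$. -}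

module Defs where

open import Data.Nat using (ℕ; zero; suc; _+_; _*_; _≤_; _<_; _⊓_; NonZero)
open import Data.Nat.DivMod using (_mod_)
open import Data.Fin using (Fin; toℕ)
open import Data.Fin.Properties using () renaming (_≟_ to _≟F_)
open import Data.Vec using (Vec; []; _∷_; lookup; zipWith; map; replicate)
open import Data.List using (List; []; _∷_; concatMap; filter; foldr; length)
import Data.List as L
open import Data.Bool using (Bool; true; false; if_then_else_)
open import Data.Product using (_×_; ∃)
open import Data.Sum using (_⊎_)
open import Relation.Nullary.Decidable using (does; _×-dec_)
open import Relation.Binary.PropositionalEquality using (_≡_)
import Data.Nat as N

F5 : Set
F5 = Fin 5

_+₅_ : F5 → F5 → F5
a +₅ b = (toℕ a + toℕ b) mod 5

_*₅_ : F5 → F5 → F5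
a *₅ b = (toℕ a * toℕ b) mod 5

Word : ℕ → Set
Word n = Vec F5 n

zeroW : ∀ {n} → Word n
zeroW = replicate _ Data.Fin.zero

_⊕_ : ∀ {n} → Word n → Word n → Word n
_⊕_ = zipWith _+₅_

_·_ : ∀ {n} → F5 → Word n → Word n
a · v = map (a *₅_) v

allWords : ∀ n → List (Word n)
allWords zero = [] ∷ []
allWords (suc n) = concatMap (λ a → L.map (a ∷_) (allWords n)) (L.allFin 5)

-- Hamming distance (= graph distance in H(n,5)).
hamming : ∀ {n} → Word n → Word n → ℕ
hamming [] [] = 0
hamming (a ∷ u) (b ∷ v) = (if does (a ≟F b) then 0 else 1) + hamming u v

Adjacent : ∀ {n} → Word n → Word n → Set
Adjacent u v = hamming u v ≡ 1

Code : ℕ → Set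
Code n = Word n → Bool

IsLinear : ∀ {n} → Code n → Set
IsLinear {n} C =
  (C zeroW ≡ true) ×
  (∀ (u v : Word n) → C u ≡ true → C v ≡ true → C (u ⊕ v) ≡ true) ×
  (∀ (a : F5) (u : Word n) → C u ≡ true → C (a · u) ≡ true)

-- Distance d(x,C) = min over codewords c of the distance from x to c.
-- (The initial value n is an upper bound of every distance, so for nonempty C
-- this is exactly the minimum.)
distC : ∀ {n} → Code n → Word n → ℕ
distC {n} C x = foldr _⊓_ n (L.map (hamming x) (filter (λ c → C c Data.Bool.≟ true) (allWords n)))

nbrCount : ∀ {n} → Code n → Word n → ℕ → ℕ
nbrCount {n} C x l =
  length (filter (λ y → (hamming x y N.≟ 1) ×-dec (distC C y N.≟ l)) (allWords n))

HasCoveringRadius : ∀ {n} → Code n → ℕ → Set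
HasCoveringRadius {n} C ρ = (∀ (x : Word n) → distC C x ≤ ρ) × ∃ (λ (x : Word n) → distC C x ≡ ρ)

IsCompletelyRegular : ∀ {n} → Code n → ℕ → Set
IsCompletelyRegular {n} C ρ =
  HasCoveringRadius C ρ ×
  (∀ (k l : ℕ) (x y : Word n) → distC C x ≡ k → distC C y ≡ k → nbrCount C x l ≡ nbrCount C y l) ×
  (∀ (k l : ℕ) (x : Word n) → distC C x ≡ k → (suc l < k ⊎ suc k < l) → nbrCount C x l ≡ 0)

-- Completely regular with intersection array {β_0,…,β_{ρ-1}; γ_1,…,γ_ρ},
-- where lookup βs i = β_i and lookup γs i = γ_{i+1}.
HasIntersectionArray : ∀ {n} → Code n → (ρ : ℕ) → Vec ℕ ρ → Vec ℕ ρ → Set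
HasIntersectionArray {n} C ρ βs γs =
  IsCompletelyRegular C ρ ×
  (∀ (i : Fin ρ) (x : Word n) → distC C x ≡ toℕ i → nbrCount C x (suc (toℕ i)) ≡ lookup βs i) ×
  (∀ (i : Fin ρ) (x : Word n) → distC C x ≡ suc (toℕ i) → nbrCount C x (toℕ i) ≡ lookup γs i)

-- The intersection array gives the 4×4 tridiagonal quotient matrix Q of the partition by distance from C,
-- with eigenvalues 52, 17, 2 and −8. Counting, for a word w, the vertices of each C^(k) lying in the
-- hyperplane w^⊥ together with their neighbours shows two things. For w = 0 the class sizes b_k form the
-- left eigenvector of Q for 52, whence |C| = 5^13/625 = 5^9. For a dual codeword w of weight t, the vector
-- 5A − b, with A_k = |C^(k) ∩ w^⊥|, is a left eigenvector for 52 − 5t whose first entry 4|C| is nonzero,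
-- so t ∈ {0, 7, 10, 12}. As |C^⊥| ≥ 5^13/|C| = 625, the dual codewords vanishing on the first two
-- coordinates contain two independent words w₁, w₂. The six points of the projective line they span are
-- nonzero dual codewords with 1, 3 or 6 zeros each; these zero counts sum to 13 + 5s and are all at least s,
-- where s ≥ 2 counts the common zeros of w₁ and w₂, which no choice of counts allows.

module Submission where

open import Level using (Level)
open import Function using (case_of_)
open import Function.Bundles using (mk⇔)
open import Data.Empty using (⊥; ⊥-elim)
open import Data.Bool using (Bool; true; false; _∧_; if_then_else_)
open import Data.Nat using (ℕ; zero; suc; _+_; _*_; _≤_; _<_; _^_; z≤n; s≤s; _⊓_)
open import Data.Nat.Properties
open import Algebra.Properties.CommutativeSemigroup +-commutativeSemigroup using (interchange)
open import Data.Nat.Tactic.RingSolver using (solve-∀)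
open import Data.Fin using (Fin; zero; suc; toℕ; fromℕ<)
open import Data.Fin.Properties using (all?; any?; toℕ-fromℕ<) renaming (_≟_ to _≟F_)
open import Data.Vec using ([]; _∷_; head; tail; lookup)
open import Data.Vec.Properties using (≡-dec)
open import Data.List using (List; []; _∷_; concatMap; filter; foldr; length; _++_)
import Data.List as L
open import Data.List.Relation.Unary.Any using (here; there)
open import Data.List.Membership.Propositional using (_∈_; lose)
open import Data.List.Membership.Propositional.Properties using (∈-map⁺; ∈-concatMap⁺; ∈-allFin)
open import Data.Product using (Σ; Σ-syntax; _×_; _,_; proj₁; proj₂)
open import Data.Sum using (_⊎_; inj₁; inj₂)
open import Relation.Nullary using (¬_; Dec; yes; no; does; ¬?)
open import Relation.Nullary.Decidable using (from-yes; decidable-stable; _→-dec_; _×-dec_; dec-true; dec-false; does-⇔)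
open import Relation.Unary using (Decidable)
open import Relation.Binary.PropositionalEquality
open import Defs

private variable
  a b : Level
  A : Set a
  B : Set b

χ : Bool → ℕ
χ true = 1
χ false = 0

⟦_⟧ : ∀ {p} {P : Set p} → Dec P → ℕ
⟦ d ⟧ = χ (does d)

χ-∧ : ∀ p q → χ (p ∧ q) ≡ χ p * χ q
χ-∧ true q = sym (+-identityʳ _)
χ-∧ false q = refl

pattern f0 = zero
pattern f1 = suc zero
pattern f2 = suc (suc zero)
pattern f3 = suc (suc (suc zero))
pattern f4 = suc (suc (suc (suc zero)))

sum₅ : (F5 → ℕ) → ℕ
sum₅ g = g f0 + (g f1 + (g f2 + (g f3 + (g f4 + 0))))

sumList : (A → ℕ) → List A → ℕ
sumList f [] = 0
sumList f (x ∷ xs) = f x + sumList f xs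

sumList-0 : ∀ (xs : List A) → sumList (λ _ → 0) xs ≡ 0
sumList-0 [] = refl
sumList-0 (_ ∷ xs) = sumList-0 xs

sumList-++ : ∀ (f : A → ℕ) xs ys → sumList f (xs ++ ys) ≡ sumList f xs + sumList f ys
sumList-++ f [] ys = refl
sumList-++ f (x ∷ xs) ys = trans (cong (f x +_) (sumList-++ f xs ys)) (sym (+-assoc (f x) _ _))

sumList-cong : ∀ {f g : A → ℕ} → (∀ x → f x ≡ g x) → ∀ xs → sumList f xs ≡ sumList g xs
sumList-cong e [] = refl
sumList-cong e (x ∷ xs) = cong₂ _+_ (e x) (sumList-cong e xs)

sumList-+ : ∀ (f g : A → ℕ) xs → sumList (λ x → f x + g x) xs ≡ sumList f xs + sumList g xs
sumList-+ f g [] = refl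
sumList-+ f g (x ∷ xs) = trans (cong ((f x + g x) +_) (sumList-+ f g xs)) (interchange (f x) (g x) _ _)

sumList-* : ∀ c (f : A → ℕ) xs → sumList (λ x → c * f x) xs ≡ c * sumList f xs
sumList-* c f [] = sym (*-zeroʳ c)
sumList-* c f (x ∷ xs) = trans (cong (c * f x +_) (sumList-* c f xs)) (sym (*-distribˡ-+ c (f x) _))

sumList-mono : ∀ {f g : A → ℕ} → (∀ x → f x ≤ g x) → ∀ xs → sumList f xs ≤ sumList g xs
sumList-mono e [] = z≤n
sumList-mono e (x ∷ xs) = +-mono-≤ (e x) (sumList-mono e xs)

sumList-map : ∀ (f : B → ℕ) (g : A → B) xs → sumList f (L.map g xs) ≡ sumList (λ x → f (g x)) xs
sumList-map f g [] = refl
sumList-map f g (x ∷ xs) = cong (f (g x) +_) (sumList-map f g xs)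

sumList-concatMap : ∀ (f : B → ℕ) (g : A → List B) xs →
                    sumList f (concatMap g xs) ≡ sumList (λ x → sumList f (g x)) xs
sumList-concatMap f g [] = refl
sumList-concatMap f g (x ∷ xs) =
  trans (sumList-++ f (g x) (concatMap g xs)) (cong (sumList f (g x) +_) (sumList-concatMap f g xs))

sumList-swap : ∀ (K : A → B → ℕ) xs ys →
               sumList (λ x → sumList (K x) ys) xs ≡ sumList (λ y → sumList (λ x → K x y) xs) ys
sumList-swap K [] ys = sym (sumList-0 ys)
sumList-swap K (x ∷ xs) ys = trans (cong (sumList (K x) ys +_) (sumList-swap K xs ys))
                                   (sym (sumList-+ (K x) (λ y → sumList (λ x → K x y) xs) ys))

⟦⟧-absorb : ∀ {p q} {P : Set p} {Q : Set q} (d : Dec P) (e : Dec Q) → (P → Q) → ⟦ e ⟧ * ⟦ d ⟧ ≡ ⟦ d ⟧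
⟦⟧-absorb (no _)  e _ = *-zeroʳ ⟦ e ⟧
⟦⟧-absorb (yes p) (yes _) _ = refl
⟦⟧-absorb (yes p) (no ¬q) f = ⊥-elim (¬q (f p))

⟦⟧≤ : ∀ {p} {P : Set p} {m} (d : Dec P) → (P → 1 ≤ m) → ⟦ d ⟧ ≤ m
⟦⟧≤ (yes p) f = f p
⟦⟧≤ (no _)  _ = z≤n

_≟W_ : ∀ {n} (u v : Word n) → Dec (u ≡ v)
_≟W_ = ≡-dec _≟F_

⟦∷≟∷⟧ : ∀ {n} (a b : F5) (v u : Word n) → ⟦ (a ∷ v) ≟W (b ∷ u) ⟧ ≡ ⟦ a ≟F b ⟧ * ⟦ v ≟W u ⟧
⟦∷≟∷⟧ a b v u = χ-∧ (does (a ≟F b)) (does (v ≟W u))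

sum₅-cong : ∀ {g h : F5 → ℕ} → (∀ a → g a ≡ h a) → sum₅ g ≡ sum₅ h
sum₅-cong e = cong₂ _+_ (e f0) (cong₂ _+_ (e f1) (cong₂ _+_ (e f2) (cong₂ _+_ (e f3) (cong₂ _+_ (e f4) refl))))

sum₅-+ : ∀ (g h : F5 → ℕ) → sum₅ (λ a → g a + h a) ≡ sum₅ g + sum₅ h
sum₅-+ g h = lemma (g f0) (g f1) (g f2) (g f3) (g f4) (h f0) (h f1) (h f2) (h f3) (h f4)
  where
    lemma : ∀ a b c d e a′ b′ c′ d′ e′ →
            (a + a′) + ((b + b′) + ((c + c′) + ((d + d′) + ((e + e′) + 0))))
            ≡ (a + (b + (c + (d + (e + 0))))) + (a′ + (b′ + (c′ + (d′ + (e′ + 0)))))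
    lemma = solve-∀

sum₅-* : ∀ c (g : F5 → ℕ) → sum₅ (λ a → c * g a) ≡ c * sum₅ g
sum₅-* c g = lemma c (g f0) (g f1) (g f2) (g f3) (g f4)
  where
    lemma : ∀ c a b d e f → c * a + (c * b + (c * d + (c * e + (c * f + 0)))) ≡ c * (a + (b + (d + (e + (f + 0)))))
    lemma = solve-∀

sum₅-const : ∀ c → sum₅ (λ _ → c) ≡ 5 * c
sum₅-const c = lemma c
  where
    lemma : ∀ c → c + (c + (c + (c + (c + 0)))) ≡ 5 * c
    lemma = solve-∀

sum₅-≥ : ∀ (g : F5 → ℕ) a → g a ≤ sum₅ g
sum₅-≥ g f0 = m≤m+n _ _
sum₅-≥ g f1 = ≤-trans (m≤m+n _ _) (m≤n+m _ (g f0))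
sum₅-≥ g f2 = ≤-trans (≤-trans (m≤m+n _ _) (m≤n+m _ (g f1))) (m≤n+m _ (g f0))
sum₅-≥ g f3 = ≤-trans (≤-trans (≤-trans (m≤m+n _ _) (m≤n+m _ (g f2))) (m≤n+m _ (g f1))) (m≤n+m _ (g f0))
sum₅-≥ g f4 =
  ≤-trans (≤-trans (≤-trans (≤-trans (m≤m+n _ _) (m≤n+m _ (g f3))) (m≤n+m _ (g f2))) (m≤n+m _ (g f1))) (m≤n+m _ (g f0))

sum₅-≡0⇒ : ∀ (g : F5 → ℕ) → sum₅ g ≡ 0 → ∀ a → g a ≡ 0
sum₅-≡0⇒ g e a = n≤0⇒n≡0 (subst (g a ≤_) e (sum₅-≥ g a))

sum₅-≢0⇒ : ∀ (g : F5 → ℕ) → sum₅ g ≢ 0 → Σ[ a ∈ F5 ] g a ≢ 0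
sum₅-≢0⇒ g ne with any? (λ a → ¬? (g a ≟ 0))
... | yes witness = witness
... | no none = ⊥-elim (ne (trans (sum₅-cong allZero) (sum₅-const 0)))
  where
    allZero : ∀ a → g a ≡ 0
    allZero a = decidable-stable (g a ≟ 0) (λ ga≢0 → none (a , ga≢0))

sum₅-pick : ∀ (b : F5) (g : F5 → ℕ) → sum₅ (λ a → ⟦ b ≟F a ⟧ * g a) ≡ g b
sum₅-pick f0 g = pick (g f0) (g f1) (g f2) (g f3) (g f4)
  where pick : ∀ a b c d e → 1 * a + (0 * b + (0 * c + (0 * d + (0 * e + 0)))) ≡ a
        pick = solve-∀
sum₅-pick f1 g = pick (g f0) (g f1) (g f2) (g f3) (g f4)
  where pick : ∀ a b c d e → 0 * a + (1 * b + (0 * c + (0 * d + (0 * e + 0)))) ≡ b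
        pick = solve-∀
sum₅-pick f2 g = pick (g f0) (g f1) (g f2) (g f3) (g f4)
  where pick : ∀ a b c d e → 0 * a + (0 * b + (1 * c + (0 * d + (0 * e + 0)))) ≡ c
        pick = solve-∀
sum₅-pick f3 g = pick (g f0) (g f1) (g f2) (g f3) (g f4)
  where pick : ∀ a b c d e → 0 * a + (0 * b + (0 * c + (1 * d + (0 * e + 0)))) ≡ d
        pick = solve-∀
sum₅-pick f4 g = pick (g f0) (g f1) (g f2) (g f3) (g f4)
  where pick : ∀ a b c d e → 0 * a + (0 * b + (0 * c + (0 * d + (1 * e + 0)))) ≡ e
        pick = solve-∀

sum₅-δ : ∀ (b : F5) → sum₅ (λ a → ⟦ b ≟F a ⟧) ≡ 1
sum₅-δ b = trans (sum₅-cong (λ a → sym (*-identityʳ ⟦ b ≟F a ⟧))) (sum₅-pick b (λ _ → 1))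

sum₅-translate : ∀ (b : F5) (g : F5 → ℕ) → sum₅ (λ a → g (a +₅ b)) ≡ sum₅ g
sum₅-translate f0 g = refl
sum₅-translate f1 g = rotate (g f0) (g f1) (g f2) (g f3) (g f4)
  where rotate : ∀ a b c d e → b + (c + (d + (e + (a + 0)))) ≡ a + (b + (c + (d + (e + 0))))
        rotate = solve-∀
sum₅-translate f2 g = rotate (g f0) (g f1) (g f2) (g f3) (g f4)
  where rotate : ∀ a b c d e → c + (d + (e + (a + (b + 0)))) ≡ a + (b + (c + (d + (e + 0))))
        rotate = solve-∀
sum₅-translate f3 g = rotate (g f0) (g f1) (g f2) (g f3) (g f4)
  where rotate : ∀ a b c d e → d + (e + (a + (b + (c + 0)))) ≡ a + (b + (c + (d + (e + 0))))
        rotate = solve-∀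
sum₅-translate f4 g = rotate (g f0) (g f1) (g f2) (g f3) (g f4)
  where rotate : ∀ a b c d e → e + (a + (b + (c + (d + 0)))) ≡ a + (b + (c + (d + (e + 0))))
        rotate = solve-∀

-- Opaque, so that type checking never unfolds a sum over the 5^n words.
opaque
  sumW : ∀ n → (Word n → ℕ) → ℕ
  sumW n f = sumList f (allWords n)

  sumW-sumList : ∀ n (f : Word n → ℕ) → sumW n f ≡ sumList f (allWords n)
  sumW-sumList n f = refl

  sumW-zero : ∀ (f : Word 0 → ℕ) → sumW 0 f ≡ f [] + 0
  sumW-zero f = refl

  sumW-suc : ∀ n (f : Word (suc n) → ℕ) → sumW (suc n) f ≡ sum₅ (λ a → sumW n (λ v → f (a ∷ v)))
  sumW-suc n f =
    trans (sumList-concatMap f (λ a → L.map (a ∷_) (allWords n)) (L.allFin 5))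
          (sum₅-cong (λ a → sumList-map f (a ∷_) (allWords n)))

  sumW-cong : ∀ n {f g : Word n → ℕ} → (∀ x → f x ≡ g x) → sumW n f ≡ sumW n g
  sumW-cong n e = sumList-cong e (allWords n)

  sumW-+ : ∀ n (f g : Word n → ℕ) → sumW n (λ x → f x + g x) ≡ sumW n f + sumW n g
  sumW-+ n f g = sumList-+ f g (allWords n)

  sumW-* : ∀ n c (f : Word n → ℕ) → sumW n (λ x → c * f x) ≡ c * sumW n f
  sumW-* n c f = sumList-* c f (allWords n)

  sumW-0 : ∀ n → sumW n (λ _ → 0) ≡ 0
  sumW-0 n = sumList-0 (allWords n)

  sumW-mono : ∀ n {f g : Word n → ℕ} → (∀ x → f x ≤ g x) → sumW n f ≤ sumW n g
  sumW-mono n e = sumList-mono e (allWords n)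

  sumW-swap : ∀ n m (K : Word n → Word m → ℕ) → sumW n (λ x → sumW m (K x)) ≡ sumW m (λ y → sumW n (λ x → K x y))
  sumW-swap n m K = sumList-swap K (allWords n) (allWords m)

sumW-sum₅ : ∀ n (K : F5 → Word n → ℕ) → sumW n (λ x → sum₅ (λ a → K a x)) ≡ sum₅ (λ a → sumW n (K a))
sumW-sum₅ n K =
  trans (sumW-+ n _ _) (cong (sumW n (K f0) +_) (trans (sumW-+ n _ _) (cong (sumW n (K f1) +_)
  (trans (sumW-+ n _ _) (cong (sumW n (K f2) +_) (trans (sumW-+ n _ _) (cong (sumW n (K f3) +_)
  (trans (sumW-+ n _ _) (cong (sumW n (K f4) +_) (sumW-0 n))))))))))

sumW-≡0⇒ : ∀ n (f : Word n → ℕ) → sumW n f ≡ 0 → ∀ x → f x ≡ 0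
sumW-≡0⇒ zero f e [] = m+n≡0⇒m≡0 (f []) (trans (sym (sumW-zero f)) e)
sumW-≡0⇒ (suc n) f e (a ∷ v) =
  sumW-≡0⇒ n (λ v → f (a ∷ v)) (sum₅-≡0⇒ (λ a → sumW n (λ v → f (a ∷ v))) (trans (sym (sumW-suc n f)) e) a) v

sumW-≢0⇒ : ∀ n (f : Word n → ℕ) → sumW n f ≢ 0 → Σ[ x ∈ Word n ] f x ≢ 0
sumW-≢0⇒ zero f ne = [] , λ e → ne (trans (sumW-zero f) (cong (_+ 0) e))
sumW-≢0⇒ (suc n) f ne with sum₅-≢0⇒ _ (λ e → ne (trans (sumW-suc n f) e))
... | a , p with sumW-≢0⇒ n (λ v → f (a ∷ v)) p
... | v , q = a ∷ v , q

sumW-1 : ∀ n → sumW n (λ _ → 1) ≡ 5 ^ n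
sumW-1 zero = sumW-zero (λ _ → 1)
sumW-1 (suc n) = trans (sumW-suc n _) (trans (sum₅-const (sumW n (λ _ → 1))) (cong (5 *_) (sumW-1 n)))

sumW-δ : ∀ n (u : Word n) → sumW n (λ x → ⟦ x ≟W u ⟧) ≡ 1
sumW-δ zero [] = sumW-zero (λ x → ⟦ x ≟W [] ⟧)
sumW-δ (suc n) (b ∷ u) = begin
  sumW (suc n) (λ x → ⟦ x ≟W (b ∷ u) ⟧)                ≡⟨ sumW-suc n _ ⟩
  sum₅ (λ a → sumW n (λ v → ⟦ (a ∷ v) ≟W (b ∷ u) ⟧))   ≡⟨ sum₅-cong fibre ⟩
  sum₅ (λ a → ⟦ b ≟F a ⟧ * 1)                          ≡⟨ sum₅-pick b (λ _ → 1) ⟩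
  1                                                    ∎
  where
    open ≡-Reasoning
    fibre : ∀ a → sumW n (λ v → ⟦ (a ∷ v) ≟W (b ∷ u) ⟧) ≡ ⟦ b ≟F a ⟧ * 1
    fibre a = begin
      sumW n (λ v → ⟦ (a ∷ v) ≟W (b ∷ u) ⟧)   ≡⟨ sumW-cong n (λ v → ⟦∷≟∷⟧ a b v u) ⟩
      sumW n (λ v → ⟦ a ≟F b ⟧ * ⟦ v ≟W u ⟧)  ≡⟨ sumW-* n ⟦ a ≟F b ⟧ _ ⟩
      ⟦ a ≟F b ⟧ * sumW n (λ v → ⟦ v ≟W u ⟧)  ≡⟨ cong₂ _*_ (cong χ (does-⇔ (mk⇔ sym sym) (a ≟F b) (b ≟F a))) (sumW-δ n u) ⟩
      ⟦ b ≟F a ⟧ * 1                           ∎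

sumW-translate : ∀ n (s : Word n) (f : Word n → ℕ) → sumW n (λ x → f (x ⊕ s)) ≡ sumW n f
sumW-translate zero [] f = trans (sumW-zero (λ x → f (x ⊕ []))) (sym (sumW-zero f))
sumW-translate (suc n) (b ∷ s) f = begin
  sumW (suc n) (λ x → f (x ⊕ (b ∷ s)))                  ≡⟨ sumW-suc n _ ⟩
  sum₅ (λ a → sumW n (λ v → f ((a +₅ b) ∷ (v ⊕ s))))    ≡⟨ sum₅-cong (λ a → sumW-translate n s (λ v → f ((a +₅ b) ∷ v))) ⟩
  sum₅ (λ a → sumW n (λ v → f ((a +₅ b) ∷ v)))          ≡⟨ sum₅-translate b (λ c → sumW n (λ v → f (c ∷ v))) ⟩
  sum₅ (λ a → sumW n (λ v → f (a ∷ v)))                 ≡⟨ sumW-suc n f ⟨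
  sumW (suc n) f                                        ∎
  where open ≡-Reasoning

*₅-zeroʳ : ∀ k → k *₅ f0 ≡ f0
*₅-zeroʳ = from-yes (all? λ k → (k *₅ f0) ≟F f0)

dot : ∀ {n} → Word n → Word n → F5
dot [] [] = f0
dot (a ∷ u) (b ∷ v) = (a *₅ b) +₅ dot u v

dot-comm : ∀ {n} (u v : Word n) → dot u v ≡ dot v u
dot-comm [] [] = refl
dot-comm (a ∷ u) (b ∷ v) = cong₂ _+₅_ (*₅-comm a b) (dot-comm u v)
  where
    *₅-comm : ∀ a b → a *₅ b ≡ b *₅ a
    *₅-comm = from-yes (all? λ a → all? λ b → (a *₅ b) ≟F (b *₅ a))

dot-zeroˡ : ∀ {n} (x : Word n) → dot zeroW x ≡ f0
dot-zeroˡ [] = refl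
dot-zeroˡ (b ∷ x) = trans (cong ((f0 *₅ b) +₅_) (dot-zeroˡ x)) (zero-*₅-+₅-zero b)
  where
    zero-*₅-+₅-zero : ∀ b → (f0 *₅ b) +₅ f0 ≡ f0
    zero-*₅-+₅-zero = from-yes (all? λ b → ((f0 *₅ b) +₅ f0) ≟F f0)

dot-zeroʳ : ∀ {n} (x : Word n) → dot x zeroW ≡ f0
dot-zeroʳ x = trans (dot-comm x zeroW) (dot-zeroˡ x)

dot-⊕ʳ : ∀ {n} (v x s : Word n) → dot v (x ⊕ s) ≡ dot v x +₅ dot v s
dot-⊕ʳ [] [] [] = refl
dot-⊕ʳ (a ∷ v) (b ∷ x) (c ∷ s) =
  trans (cong ((a *₅ (b +₅ c)) +₅_) (dot-⊕ʳ v x s)) (distrib-interchange a b c (dot v x) (dot v s))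
  where
    distrib-interchange : ∀ a b c d e → (a *₅ (b +₅ c)) +₅ (d +₅ e) ≡ ((a *₅ b) +₅ d) +₅ ((a *₅ c) +₅ e)
    distrib-interchange = from-yes (all? λ a → all? λ b → all? λ c → all? λ d → all? λ e →
                            ((a *₅ (b +₅ c)) +₅ (d +₅ e)) ≟F (((a *₅ b) +₅ d) +₅ ((a *₅ c) +₅ e)))

dot-·ʳ : ∀ {n} (v : Word n) k x → dot v (k · x) ≡ k *₅ dot v x
dot-·ʳ [] k [] = sym (*₅-zeroʳ k)
dot-·ʳ (a ∷ v) k (b ∷ x) = trans (cong ((a *₅ (k *₅ b)) +₅_) (dot-·ʳ v k x)) (scale-out a k b (dot v x))
  where
    scale-out : ∀ a k b d → (a *₅ (k *₅ b)) +₅ (k *₅ d) ≡ k *₅ ((a *₅ b) +₅ d)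
    scale-out = from-yes (all? λ a → all? λ k → all? λ b → all? λ d →
                  ((a *₅ (k *₅ b)) +₅ (k *₅ d)) ≟F (k *₅ ((a *₅ b) +₅ d)))

⊕-⊕-4· : ∀ {n} (x s : Word n) → (x ⊕ s) ⊕ (f4 · s) ≡ x
⊕-⊕-4· [] [] = refl
⊕-⊕-4· (a ∷ x) (b ∷ s) = cong₂ _∷_ (cancel a b) (⊕-⊕-4· x s)
  where
    cancel : ∀ a b → (a +₅ b) +₅ (f4 *₅ b) ≡ a
    cancel = from-yes (all? λ a → all? λ b → ((a +₅ b) +₅ (f4 *₅ b)) ≟F a)

translate-invariant : ∀ {n} {E : Code n} → IsLinear E → ∀ {s} → E s ≡ true → ∀ x → E (x ⊕ s) ≡ E x
translate-invariant {E = E} (_ , ⊕-closed , ·-closed) {s} s∈E x with E x in x∈E | E (x ⊕ s) in x⊕s∈E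
... | true  | true  = refl
... | false | false = refl
... | true  | false = sym (trans (sym (⊕-closed x s x∈E s∈E)) x⊕s∈E)
... | false | true  = trans (sym (subst (λ y → E y ≡ true) (⊕-⊕-4· x s) back)) x∈E
  where
    back : E ((x ⊕ s) ⊕ (f4 · s)) ≡ true
    back = ⊕-closed (x ⊕ s) (f4 · s) x⊕s∈E (·-closed f4 s s∈E)

∣_∣ : ∀ {n} → Code n → ℕ
∣_∣ {n} E = sumW n (λ x → χ (E x))

Orthogonal : ∀ {n} → Word n → Code n → Set
Orthogonal v E = ∀ c → E c ≡ true → dot v c ≡ f0

_∩⊥_ : ∀ {n} → Code n → Word n → Code n
(E ∩⊥ v) x = E x ∧ does (dot v x ≟F f0)

*₅-solvable : ∀ a d → d ≢ f0 → Σ[ k ∈ F5 ] k *₅ d ≡ a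
*₅-solvable = from-yes (all? λ a → all? λ d → ¬? (d ≟F f0) →-dec any? (λ k → (k *₅ d) ≟F a))

module _ {n} (E : Code n) (v : Word n) where

  levelSize : F5 → ℕ
  levelSize a = sumW n (λ x → χ (E x) * ⟦ dot v x ≟F a ⟧)

  ∣∩⊥∣≡levelSize0 : ∣ E ∩⊥ v ∣ ≡ levelSize f0
  ∣∩⊥∣≡levelSize0 = sumW-cong n (λ x → χ-∧ (E x) (does (dot v x ≟F f0)))

  ∣∣≡sum-levelSize : ∣ E ∣ ≡ sum₅ levelSize
  ∣∣≡sum-levelSize = begin
    sumW n (λ x → χ (E x))                                  ≡⟨ sumW-cong n split ⟩
    sumW n (λ x → sum₅ (λ a → χ (E x) * ⟦ dot v x ≟F a ⟧))  ≡⟨ sumW-sum₅ n (λ a x → χ (E x) * ⟦ dot v x ≟F a ⟧) ⟩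
    sum₅ levelSize                                          ∎
    where
      open ≡-Reasoning
      split : ∀ x → χ (E x) ≡ sum₅ (λ a → χ (E x) * ⟦ dot v x ≟F a ⟧)
      split x = sym (trans (sum₅-* (χ (E x)) (λ a → ⟦ dot v x ≟F a ⟧)) (trans (cong (χ (E x) *_) (sum₅-δ (dot v x))) (*-identityʳ _)))

  -- Translating by a suitable multiple of a codeword c with v·c ≠ 0 maps each level set of v onto the kernel.
  levelSize-constant : IsLinear E → ∀ {c} → E c ≡ true → dot v c ≢ f0 → ∀ a → levelSize a ≡ levelSize f0
  levelSize-constant lin@(_ , _ , ·-closed) {c} c∈E vc≢0 a with *₅-solvable a (dot v c) vc≢0
  ... | k , kvc≡a = begin
    sumW n (λ x → χ (E x) * ⟦ dot v x ≟F a ⟧)              ≡⟨ sumW-translate n s (λ x → χ (E x) * ⟦ dot v x ≟F a ⟧) ⟨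
    sumW n (λ x → χ (E (x ⊕ s)) * ⟦ dot v (x ⊕ s) ≟F a ⟧)  ≡⟨ sumW-cong n shifted ⟩
    sumW n (λ x → χ (E x) * ⟦ dot v x ≟F f0 ⟧)             ∎
    where
      open ≡-Reasoning
      s : Word n
      s = k · c
      vs≡a : dot v s ≡ a
      vs≡a = trans (dot-·ʳ v k c) kvc≡a
      +a≡a : ∀ d → ⟦ (d +₅ a) ≟F a ⟧ ≡ ⟦ d ≟F f0 ⟧
      +a≡a d = from-yes (all? λ a → all? λ d → ⟦ (d +₅ a) ≟F a ⟧ ≟ ⟦ d ≟F f0 ⟧) a d
      shifted : ∀ x → χ (E (x ⊕ s)) * ⟦ dot v (x ⊕ s) ≟F a ⟧ ≡ χ (E x) * ⟦ dot v x ≟F f0 ⟧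
      shifted x = cong₂ _*_ (cong χ (translate-invariant lin (·-closed k c c∈E) x))
                            (trans (cong (λ d → ⟦ d ≟F a ⟧) (trans (dot-⊕ʳ v x s) (cong (dot v x +₅_) vs≡a))) (+a≡a (dot v x)))

  private
    offKernel : Word n → ℕ
    offKernel x = χ (E x) * ⟦ ¬? (dot v x ≟F f0) ⟧

  orthogonal-or-witness : Orthogonal v E ⊎ Σ[ c ∈ Word n ] (E c ≡ true × dot v c ≢ f0)
  orthogonal-or-witness with sumW n offKernel ≟ 0
  ... | yes ≡0 = inj₁ (λ c → kernel c (sumW-≡0⇒ n offKernel ≡0 c))
    where
      kernel : ∀ c → offKernel c ≡ 0 → E c ≡ true → dot v c ≡ f0
      kernel c e c∈E with E c | dot v c ≟F f0
      ... | _     | yes vc≡0 = vc≡0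
      ... | true  | no _     = case e of λ ()
      ... | false | no _     = case c∈E of λ ()
  ... | no ≢0 with sumW-≢0⇒ n offKernel ≢0
  ... | c , p = inj₂ (c , witness p)
    where
      witness : offKernel c ≢ 0 → E c ≡ true × dot v c ≢ f0
      witness p with E c | dot v c ≟F f0
      ... | true  | no vc≢0 = refl , vc≢0
      ... | true  | yes _   = ⊥-elim (p refl)
      ... | false | _       = ⊥-elim (p refl)

  orthogonal? : Dec (Orthogonal v E)
  orthogonal? with orthogonal-or-witness
  ... | inj₁ v⊥E = yes v⊥E
  ... | inj₂ (c , c∈E , vc≢0) = no (λ v⊥E → vc≢0 (v⊥E c c∈E))

  non-orthogonal-witness : ¬ Orthogonal v E → Σ[ c ∈ Word n ] (E c ≡ true × dot v c ≢ f0)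
  non-orthogonal-witness v⊥̸E with orthogonal-or-witness
  ... | inj₁ v⊥E = ⊥-elim (v⊥̸E v⊥E)
  ... | inj₂ c   = c

  section-size : IsLinear E → 5 * ∣ E ∩⊥ v ∣ ≡ ∣ E ∣ * (1 + 4 * ⟦ orthogonal? ⟧)
  section-size lin with orthogonal?
  ... | yes v⊥E = trans (cong (5 *_) (sumW-cong n in-kernel)) (*-comm 5 ∣ E ∣)
    where
      in-kernel : ∀ x → χ ((E ∩⊥ v) x) ≡ χ (E x)
      in-kernel x with E x in x∈E
      ... | true  = cong χ (dec-true (dot v x ≟F f0) (v⊥E x x∈E))
      ... | false = refl
  ... | no v⊥̸E with non-orthogonal-witness v⊥̸E
  ... | c , c∈E , vc≢0 = begin
    5 * ∣ E ∩⊥ v ∣              ≡⟨ cong (5 *_) ∣∩⊥∣≡levelSize0 ⟩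
    5 * levelSize f0            ≡⟨ sum₅-const (levelSize f0) ⟨
    sum₅ (λ _ → levelSize f0)   ≡⟨ sum₅-cong (levelSize-constant lin c∈E vc≢0) ⟨
    sum₅ levelSize              ≡⟨ ∣∣≡sum-levelSize ⟨
    ∣ E ∣                       ≡⟨ *-identityʳ ∣ E ∣ ⟨
    ∣ E ∣ * 1                   ∎
    where open ≡-Reasoning

  section-size-≥ : IsLinear E → ∣ E ∣ ≤ 5 * ∣ E ∩⊥ v ∣
  section-size-≥ lin = subst (∣ E ∣ ≤_) (sym (section-size lin)) (m≤m*n ∣ E ∣ (1 + 4 * ⟦ orthogonal? ⟧))

module _ {n} {E : Code n} {v : Word n} {x : Word n} where

  ∩⊥⇒∈ : (E ∩⊥ v) x ≡ true → E x ≡ true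
  ∩⊥⇒∈ e with E x
  ... | true = refl

  ∩⊥⇒⊥ : (E ∩⊥ v) x ≡ true → dot v x ≡ f0
  ∩⊥⇒⊥ e with E x | dot v x ≟F f0
  ... | true | yes vx≡0 = vx≡0

  ∈⊥⇒∩⊥ : E x ≡ true → dot v x ≡ f0 → (E ∩⊥ v) x ≡ true
  ∈⊥⇒∩⊥ x∈E vx≡0 rewrite x∈E = dec-true (dot v x ≟F f0) vx≡0

∩⊥-linear : ∀ {n} {E : Code n} → IsLinear E → ∀ v → IsLinear (E ∩⊥ v)
∩⊥-linear {E = E} (zero∈ , ⊕-closed , ·-closed) v =
  both zero∈ (dot-zeroʳ v) ,
  (λ x y x∈ y∈ → both (⊕-closed x y (∈E x∈) (∈E y∈)) (trans (dot-⊕ʳ v x y) (cong₂ _+₅_ (⊥v x∈) (⊥v y∈)))) ,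
  (λ k x x∈ → both (·-closed k x (∈E x∈)) (trans (dot-·ʳ v k x) (trans (cong (k *₅_) (⊥v x∈)) (*₅-zeroʳ k))))
  where
    ∈E : ∀ {x} → (E ∩⊥ v) x ≡ true → E x ≡ true
    ∈E = ∩⊥⇒∈ {E = E} {v = v}
    ⊥v : ∀ {x} → (E ∩⊥ v) x ≡ true → dot v x ≡ f0
    ⊥v = ∩⊥⇒⊥ {E = E} {v = v}
    both : ∀ {x} → E x ≡ true → dot v x ≡ f0 → (E ∩⊥ v) x ≡ true
    both = ∈⊥⇒∩⊥ {E = E} {v = v}

dual : ∀ {n} → Code n → Code n
dual E w = does (orthogonal? E w)

module _ {n} {E : Code n} where

  dual⇒orthogonal : ∀ {w} → dual E w ≡ true → Orthogonal w E
  dual⇒orthogonal {w} w∈ with orthogonal? E w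
  ... | yes w⊥E = w⊥E

  orthogonal⇒dual : ∀ {w} → Orthogonal w E → dual E w ≡ true
  orthogonal⇒dual {w} = dec-true (orthogonal? E w)

  dual-linear : IsLinear (dual E)
  dual-linear =
    orthogonal⇒dual (λ c _ → dot-zeroˡ c) ,
    (λ u v u∈ v∈ → orthogonal⇒dual (λ c c∈E →
       trans (dot-comm (u ⊕ v) c) (trans (dot-⊕ʳ c u v) (cong₂ _+₅_ (⊥ˡ u∈ c∈E) (⊥ˡ v∈ c∈E))))) ,
    (λ k u u∈ → orthogonal⇒dual (λ c c∈E →
       trans (dot-comm (k · u) c) (trans (dot-·ʳ c k u) (trans (cong (k *₅_) (⊥ˡ u∈ c∈E)) (*₅-zeroʳ k)))))
    where
      ⊥ˡ : ∀ {u c} → dual E u ≡ true → E c ≡ true → dot c u ≡ f0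
      ⊥ˡ {u} {c} u∈ c∈E = trans (dot-comm c u) (dual⇒orthogonal u∈ c c∈E)

full : ∀ {n} → Code n
full _ = true

full-linear : ∀ {n} → IsLinear (full {n})
full-linear = refl , (λ _ _ _ _ → refl) , (λ _ _ _ → refl)

∣full∩⊥zero∣ : ∀ n → ∣ full {n} ∩⊥ zeroW ∣ ≡ 5 ^ n
∣full∩⊥zero∣ n = trans (sumW-cong n (λ w → cong χ (dec-true (dot zeroW w ≟F f0) (dot-zeroˡ w)))) (sumW-1 n)

-- Count pairs (w, x) with x ∈ E and w·x = 0 in both orders.
dual-size : ∀ {n} {E : Code n} → IsLinear E → 5 ^ n ≤ ∣ E ∣ * ∣ dual E ∣
dual-size {n} {E} lin@(zero∈ , _) = *-cancelˡ-≤ 4 (+-cancelˡ-≤ (5 ^ n * ∣ E ∣) (4 * 5 ^ n) (4 * (∣ E ∣ * ∣ dual E ∣)) chain)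
  where
    open ≤-Reasoning
    pairs : ℕ
    pairs = sumW n (λ w → ∣ E ∩⊥ w ∣)

    swapped : pairs ≡ sumW n (λ x → χ (E x) * ∣ full ∩⊥ x ∣)
    swapped = trans (sumW-swap n n (λ w x → χ ((E ∩⊥ w) x)))
                    (sumW-cong n (λ x → trans (sumW-cong n (pointwise x)) (sumW-* n (χ (E x)) _)))
      where
        pointwise : ∀ x w → χ ((E ∩⊥ w) x) ≡ χ (E x) * χ ((full ∩⊥ x) w)
        pointwise x w = trans (χ-∧ (E x) _) (cong (λ d → χ (E x) * ⟦ d ≟F f0 ⟧) (dot-comm w x))

    by-sections : 5 * pairs ≡ ∣ E ∣ * (5 ^ n + 4 * ∣ dual E ∣)
    by-sections = begin-equality
      5 * pairs                                            ≡⟨ sumW-* n 5 _ ⟨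
      sumW n (λ w → 5 * ∣ E ∩⊥ w ∣)                        ≡⟨ sumW-cong n (λ w → section-size E w lin) ⟩
      sumW n (λ w → ∣ E ∣ * (1 + 4 * χ (dual E w)))        ≡⟨ sumW-* n ∣ E ∣ _ ⟩
      ∣ E ∣ * sumW n (λ w → 1 + 4 * χ (dual E w))          ≡⟨ cong (∣ E ∣ *_) (sumW-+ n _ _) ⟩
      ∣ E ∣ * (sumW n (λ _ → 1) + sumW n (λ w → 4 * χ (dual E w)))
                                                           ≡⟨ cong (∣ E ∣ *_) (cong₂ _+_ (sumW-1 n) (sumW-* n 4 _)) ⟩
      ∣ E ∣ * (5 ^ n + 4 * ∣ dual E ∣)                     ∎

    -- Every kernel x^⊥ has at least 5^(n-1) elements, and 0^⊥ has 5^n.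
    pointwise-bound : ∀ x → χ (E x) * 5 ^ n + 4 * 5 ^ n * ⟦ x ≟W zeroW ⟧ ≤ 5 * (χ (E x) * ∣ full ∩⊥ x ∣)
    pointwise-bound x with x ≟W zeroW
    ... | yes refl rewrite zero∈ | ∣full∩⊥zero∣ n = ≤-reflexive (lemma (5 ^ n))
      where
        lemma : ∀ p → 1 * p + 4 * p * 1 ≡ 5 * (1 * p)
        lemma = solve-∀
    ... | no _ = begin
      χ (E x) * 5 ^ n + 4 * 5 ^ n * 0   ≡⟨ cong (χ (E x) * 5 ^ n +_) (*-zeroʳ (4 * 5 ^ n)) ⟩
      χ (E x) * 5 ^ n + 0               ≡⟨ +-identityʳ _ ⟩
      χ (E x) * 5 ^ n                   ≤⟨ *-monoʳ-≤ (χ (E x)) (subst (_≤ 5 * ∣ full ∩⊥ x ∣) (sumW-1 n) (section-size-≥ full x full-linear)) ⟩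
      χ (E x) * (5 * ∣ full ∩⊥ x ∣)     ≡⟨ *-comm (χ (E x)) _ ⟩
      5 * ∣ full ∩⊥ x ∣ * χ (E x)       ≡⟨ *-assoc 5 (∣ full ∩⊥ x ∣) (χ (E x)) ⟩
      5 * (∣ full ∩⊥ x ∣ * χ (E x))     ≡⟨ cong (5 *_) (*-comm _ (χ (E x))) ⟩
      5 * (χ (E x) * ∣ full ∩⊥ x ∣)     ∎

    by-kernels : 5 ^ n * ∣ E ∣ + 4 * 5 ^ n ≤ 5 * pairs
    by-kernels = begin
      5 ^ n * ∣ E ∣ + 4 * 5 ^ n                   ≡⟨ cong₂ _+_ (sumW-* n (5 ^ n) _) (trans (cong (4 * 5 ^ n *_) (sumW-δ n zeroW)) (*-identityʳ _)) ⟨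
      sumW n (λ x → 5 ^ n * χ (E x)) + 4 * 5 ^ n * sumW n (λ x → ⟦ x ≟W zeroW ⟧)
                                                  ≡⟨ cong₂ _+_ (sumW-cong n (λ x → *-comm (χ (E x)) (5 ^ n))) (sumW-* n (4 * 5 ^ n) _) ⟨
      sumW n (λ x → χ (E x) * 5 ^ n) + sumW n (λ x → 4 * 5 ^ n * ⟦ x ≟W zeroW ⟧)
                                                  ≡⟨ sumW-+ n _ _ ⟨
      sumW n (λ x → χ (E x) * 5 ^ n + 4 * 5 ^ n * ⟦ x ≟W zeroW ⟧)
                                                  ≤⟨ sumW-mono n pointwise-bound ⟩
      sumW n (λ x → 5 * (χ (E x) * ∣ full ∩⊥ x ∣)) ≡⟨ sumW-* n 5 _ ⟩
      5 * sumW n (λ x → χ (E x) * ∣ full ∩⊥ x ∣)   ≡⟨ cong (5 *_) swapped ⟨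
      5 * pairs                                   ∎

    chain : 5 ^ n * ∣ E ∣ + 4 * 5 ^ n ≤ 5 ^ n * ∣ E ∣ + 4 * (∣ E ∣ * ∣ dual E ∣)
    chain = begin
      5 ^ n * ∣ E ∣ + 4 * 5 ^ n                  ≤⟨ by-kernels ⟩
      5 * pairs                                  ≡⟨ by-sections ⟩
      ∣ E ∣ * (5 ^ n + 4 * ∣ dual E ∣)           ≡⟨ lemma (∣ E ∣) (5 ^ n) (∣ dual E ∣) ⟩
      5 ^ n * ∣ E ∣ + 4 * (∣ E ∣ * ∣ dual E ∣)   ∎
      where
        lemma : ∀ e p d → e * (p + 4 * d) ≡ p * e + 4 * (e * d)
        lemma = solve-∀

zeros : ∀ {n} → Word n → ℕ
zeros [] = 0
zeros (a ∷ w) = ⟦ a ≟F f0 ⟧ + zeros w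

weight : ∀ {n} → Word n → ℕ
weight [] = 0
weight (a ∷ w) = ⟦ ¬? (a ≟F f0) ⟧ + weight w

zeros+weight : ∀ {n} (w : Word n) → zeros w + weight w ≡ n
zeros+weight [] = refl
zeros+weight (a ∷ w) with a ≟F f0
... | yes _ = cong suc (zeros+weight w)
... | no _  = trans (+-suc (zeros w) (weight w)) (cong suc (zeros+weight w))

weight≡0⇒≡zeroW : ∀ {n} (w : Word n) → weight w ≡ 0 → w ≡ zeroW
weight≡0⇒≡zeroW [] _ = refl
weight≡0⇒≡zeroW (a ∷ w) e with a ≟F f0
... | yes refl = cong (f0 ∷_) (weight≡0⇒≡zeroW w e)

private
  _-₅_ : F5 → F5 → F5
  c -₅ d = c +₅ (f4 *₅ d)

  level-shift : ∀ u a d c → ⟦ ((u *₅ a) +₅ d) ≟F c ⟧ ≡ ⟦ d ≟F (c -₅ (u *₅ a)) ⟧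
  level-shift = from-yes (all? λ u → all? λ a → all? λ d → all? λ c →
                  ⟦ ((u *₅ a) +₅ d) ≟F c ⟧ ≟ ⟦ d ≟F (c -₅ (u *₅ a)) ⟧)

  headDistance : F5 → F5 → ℕ
  headDistance b a = if does (b ≟F a) then 0 else 1

  headDistance+≡0 : ∀ b a h → ⟦ (headDistance b a + h) ≟ 0 ⟧ ≡ ⟦ b ≟F a ⟧ * ⟦ h ≟ 0 ⟧
  headDistance+≡0 b a h with b ≟F a
  ... | yes _ = sym (+-identityʳ _)
  ... | no _  = refl

  headDistance+≡1 : ∀ b a h → ⟦ (headDistance b a + h) ≟ 1 ⟧ ≡ ⟦ b ≟F a ⟧ * ⟦ h ≟ 1 ⟧ + ⟦ ¬? (b ≟F a) ⟧ * ⟦ h ≟ 0 ⟧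
  headDistance+≡1 b a h with b ≟F a
  headDistance+≡1 b a zero          | yes _ = refl
  headDistance+≡1 b a (suc zero)    | yes _ = refl
  headDistance+≡1 b a (suc (suc h)) | yes _ = refl
  headDistance+≡1 b a zero          | no _  = refl
  headDistance+≡1 b a (suc zero)    | no _  = refl
  headDistance+≡1 b a (suc (suc h)) | no _  = refl

coincident-in-level : ∀ n (y w : Word n) c →
                      sumW n (λ x → ⟦ hamming y x ≟ 0 ⟧ * ⟦ dot w x ≟F c ⟧) ≡ ⟦ dot w y ≟F c ⟧
coincident-in-level zero [] [] c = trans (sumW-zero _) (trans (+-identityʳ _) (*-identityˡ _))
coincident-in-level (suc n) (b ∷ y) (u ∷ w) c = begin
  sumW (suc n) (λ x → ⟦ hamming (b ∷ y) x ≟ 0 ⟧ * ⟦ dot (u ∷ w) x ≟F c ⟧)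
    ≡⟨ sumW-suc n _ ⟩
  sum₅ (λ a → sumW n (λ x → ⟦ (headDistance b a + hamming y x) ≟ 0 ⟧ * ⟦ ((u *₅ a) +₅ dot w x) ≟F c ⟧))
    ≡⟨ sum₅-cong (λ a → trans (sumW-cong n (split a)) (sumW-* n ⟦ b ≟F a ⟧ _)) ⟩
  sum₅ (λ a → ⟦ b ≟F a ⟧ * sumW n (λ x → ⟦ hamming y x ≟ 0 ⟧ * ⟦ dot w x ≟F (c -₅ (u *₅ a)) ⟧))
    ≡⟨ sum₅-cong (λ a → cong (⟦ b ≟F a ⟧ *_) (coincident-in-level n y w (c -₅ (u *₅ a)))) ⟩
  sum₅ (λ a → ⟦ b ≟F a ⟧ * ⟦ dot w y ≟F (c -₅ (u *₅ a)) ⟧)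
    ≡⟨ sum₅-pick b (λ a → ⟦ dot w y ≟F (c -₅ (u *₅ a)) ⟧) ⟩
  ⟦ dot w y ≟F (c -₅ (u *₅ b)) ⟧
    ≡⟨ level-shift u b (dot w y) c ⟨
  ⟦ ((u *₅ b) +₅ dot w y) ≟F c ⟧ ∎
  where
    open ≡-Reasoning
    split : ∀ a x → ⟦ (headDistance b a + hamming y x) ≟ 0 ⟧ * ⟦ ((u *₅ a) +₅ dot w x) ≟F c ⟧
                    ≡ ⟦ b ≟F a ⟧ * (⟦ hamming y x ≟ 0 ⟧ * ⟦ dot w x ≟F (c -₅ (u *₅ a)) ⟧)
    split a x = trans (cong₂ _*_ (headDistance+≡0 b a (hamming y x)) (level-shift u a (dot w x) c))
                      (*-assoc ⟦ b ≟F a ⟧ _ _)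

-- A neighbour of y changes one coordinate i by some e ≠ 0, moving w·y by w_i e: not at all when
-- w_i = 0, and onto each of the four other values of F₅ exactly once when w_i ≠ 0.
adjacent-in-level : ∀ n (y w : Word n) c →
                    sumW n (λ x → ⟦ hamming y x ≟ 1 ⟧ * ⟦ dot w x ≟F c ⟧)
                    ≡ 4 * zeros w * ⟦ dot w y ≟F c ⟧ + weight w * ⟦ ¬? (dot w y ≟F c) ⟧
adjacent-in-level zero [] [] c = sumW-zero _
adjacent-in-level (suc n) (b ∷ y) (u ∷ w) c = begin
  sumW (suc n) (λ x → ⟦ hamming (b ∷ y) x ≟ 1 ⟧ * ⟦ dot (u ∷ w) x ≟F c ⟧)
    ≡⟨ sumW-suc n _ ⟩
  sum₅ (λ a → sumW n (λ x → ⟦ (headDistance b a + hamming y x) ≟ 1 ⟧ * ⟦ ((u *₅ a) +₅ dot w x) ≟F c ⟧))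
    ≡⟨ sum₅-cong by-head ⟩
  sum₅ (λ a → ⟦ b ≟F a ⟧ * tail-count (c -₅ (u *₅ a)) + ⟦ ¬? (b ≟F a) ⟧ * ⟦ D ≟F (c -₅ (u *₅ a)) ⟧)
    ≡⟨ sum₅-+ (λ a → ⟦ b ≟F a ⟧ * tail-count (c -₅ (u *₅ a))) (λ a → ⟦ ¬? (b ≟F a) ⟧ * ⟦ D ≟F (c -₅ (u *₅ a)) ⟧) ⟩
  sum₅ (λ a → ⟦ b ≟F a ⟧ * tail-count (c -₅ (u *₅ a))) + sum₅ (λ a → ⟦ ¬? (b ≟F a) ⟧ * ⟦ D ≟F (c -₅ (u *₅ a)) ⟧)
    ≡⟨ cong₂ _+_ (sum₅-pick b (λ a → tail-count (c -₅ (u *₅ a)))) (head-moves u b D c) ⟩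
  tail-count (c -₅ (u *₅ b)) + (4 * ⟦ u ≟F f0 ⟧ * ⟦ uD ≟F c ⟧ + ⟦ ¬? (u ≟F f0) ⟧ * ⟦ ¬? (uD ≟F c) ⟧)
    ≡⟨ cong (_+ (4 * ⟦ u ≟F f0 ⟧ * ⟦ uD ≟F c ⟧ + ⟦ ¬? (u ≟F f0) ⟧ * ⟦ ¬? (uD ≟F c) ⟧)) (cong₂ (λ p q → 4 * zeros w * p + weight w * q) (level-shift u b D c) (level-shift-≢ u b D c)) ⟨
  (4 * zeros w * ⟦ uD ≟F c ⟧ + weight w * ⟦ ¬? (uD ≟F c) ⟧) + (4 * ⟦ u ≟F f0 ⟧ * ⟦ uD ≟F c ⟧ + ⟦ ¬? (u ≟F f0) ⟧ * ⟦ ¬? (uD ≟F c) ⟧)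
    ≡⟨ collect (zeros w) (weight w) ⟦ uD ≟F c ⟧ ⟦ ¬? (uD ≟F c) ⟧ ⟦ u ≟F f0 ⟧ ⟦ ¬? (u ≟F f0) ⟧ ⟩
  4 * zeros (u ∷ w) * ⟦ uD ≟F c ⟧ + weight (u ∷ w) * ⟦ ¬? (uD ≟F c) ⟧ ∎
  where
    open ≡-Reasoning
    D = dot w y
    uD = (u *₅ b) +₅ D

    tail-count : F5 → ℕ
    tail-count e = 4 * zeros w * ⟦ D ≟F e ⟧ + weight w * ⟦ ¬? (D ≟F e) ⟧

    head-moves : ∀ u b D c → sum₅ (λ a → ⟦ ¬? (b ≟F a) ⟧ * ⟦ D ≟F (c -₅ (u *₅ a)) ⟧)
                             ≡ 4 * ⟦ u ≟F f0 ⟧ * ⟦ ((u *₅ b) +₅ D) ≟F c ⟧ + ⟦ ¬? (u ≟F f0) ⟧ * ⟦ ¬? (((u *₅ b) +₅ D) ≟F c) ⟧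
    head-moves = from-yes (all? λ u → all? λ b → all? λ D → all? λ c →
                   sum₅ (λ a → ⟦ ¬? (b ≟F a) ⟧ * ⟦ D ≟F (c -₅ (u *₅ a)) ⟧)
                   ≟ (4 * ⟦ u ≟F f0 ⟧ * ⟦ ((u *₅ b) +₅ D) ≟F c ⟧ + ⟦ ¬? (u ≟F f0) ⟧ * ⟦ ¬? (((u *₅ b) +₅ D) ≟F c) ⟧))

    level-shift-≢ : ∀ u b D c → ⟦ ¬? (((u *₅ b) +₅ D) ≟F c) ⟧ ≡ ⟦ ¬? (D ≟F (c -₅ (u *₅ b))) ⟧
    level-shift-≢ = from-yes (all? λ u → all? λ b → all? λ D → all? λ c →
                      ⟦ ¬? (((u *₅ b) +₅ D) ≟F c) ⟧ ≟ ⟦ ¬? (D ≟F (c -₅ (u *₅ b))) ⟧)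

    collect : ∀ z m X Y U V → (4 * z * X + m * Y) + (4 * U * X + V * Y) ≡ 4 * (U + z) * X + (V + m) * Y
    collect = solve-∀

    distribute : ∀ p q r s t → (p * q + r * s) * t ≡ p * (q * t) + r * (s * t)
    distribute = solve-∀

    by-head : ∀ a → sumW n (λ x → ⟦ (headDistance b a + hamming y x) ≟ 1 ⟧ * ⟦ ((u *₅ a) +₅ dot w x) ≟F c ⟧)
                    ≡ ⟦ b ≟F a ⟧ * tail-count (c -₅ (u *₅ a)) + ⟦ ¬? (b ≟F a) ⟧ * ⟦ D ≟F (c -₅ (u *₅ a)) ⟧
    by-head a = begin
      sumW n (λ x → ⟦ (headDistance b a + hamming y x) ≟ 1 ⟧ * ⟦ ((u *₅ a) +₅ dot w x) ≟F c ⟧)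
        ≡⟨ sumW-cong n (λ x → trans (cong₂ _*_ (headDistance+≡1 b a (hamming y x)) (level-shift u a (dot w x) c))
                                    (distribute ⟦ b ≟F a ⟧ _ ⟦ ¬? (b ≟F a) ⟧ _ _)) ⟩
      sumW n (λ x → ⟦ b ≟F a ⟧ * (⟦ hamming y x ≟ 1 ⟧ * lvl x) + ⟦ ¬? (b ≟F a) ⟧ * (⟦ hamming y x ≟ 0 ⟧ * lvl x))
        ≡⟨ trans (sumW-+ n _ _) (cong₂ _+_ (sumW-* n ⟦ b ≟F a ⟧ _) (sumW-* n ⟦ ¬? (b ≟F a) ⟧ _)) ⟩
      ⟦ b ≟F a ⟧ * sumW n (λ x → ⟦ hamming y x ≟ 1 ⟧ * lvl x) + ⟦ ¬? (b ≟F a) ⟧ * sumW n (λ x → ⟦ hamming y x ≟ 0 ⟧ * lvl x)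
        ≡⟨ cong₂ (λ p q → ⟦ b ≟F a ⟧ * p + ⟦ ¬? (b ≟F a) ⟧ * q)
                 (adjacent-in-level n y w (c -₅ (u *₅ a))) (coincident-in-level n y w (c -₅ (u *₅ a))) ⟩
      ⟦ b ≟F a ⟧ * tail-count (c -₅ (u *₅ a)) + ⟦ ¬? (b ≟F a) ⟧ * ⟦ D ≟F (c -₅ (u *₅ a)) ⟧ ∎
      where
        lvl : Word n → ℕ
        lvl x = ⟦ dot w x ≟F (c -₅ (u *₅ a)) ⟧

allWords-complete : ∀ n (x : Word n) → x ∈ allWords n
allWords-complete zero [] = here refl
allWords-complete (suc n) (a ∷ v) =
  ∈-concatMap⁺ (λ b → L.map (b ∷_) (allWords n)) (lose (∈-allFin a) (∈-map⁺ (a ∷_) (allWords-complete n v)))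

length-filter : ∀ {A : Set} {P : A → Set} (P? : Decidable P) xs → length (filter P? xs) ≡ sumList (λ y → ⟦ P? y ⟧) xs
length-filter P? [] = refl
length-filter P? (x ∷ xs) with does (P? x)
... | true  = cong suc (length-filter P? xs)
... | false = length-filter P? xs

nbrCount-sumW : ∀ {n} (C : Code n) x l → nbrCount C x l ≡ sumW n (λ y → ⟦ hamming x y ≟ 1 ⟧ * ⟦ distC C y ≟ l ⟧)
nbrCount-sumW {n} C x l =
  trans (length-filter _ (allWords n))
        (trans (sym (sumW-sumList n _)) (sumW-cong n (λ y → χ-∧ (does (hamming x y ≟ 1)) (does (distC C y ≟ l)))))

hamming-refl : ∀ {n} (x : Word n) → hamming x x ≡ 0
hamming-refl [] = refl
hamming-refl (a ∷ x) rewrite dec-true (a ≟F a) refl = hamming-refl x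

hamming-sym : ∀ {n} (x y : Word n) → hamming x y ≡ hamming y x
hamming-sym [] [] = refl
hamming-sym (a ∷ x) (b ∷ y) rewrite does-⇔ (mk⇔ sym sym) (a ≟F b) (b ≟F a) = cong (_ +_) (hamming-sym x y)

hamming≡0⇒≡ : ∀ {n} (x y : Word n) → hamming x y ≡ 0 → x ≡ y
hamming≡0⇒≡ [] [] _ = refl
hamming≡0⇒≡ (a ∷ x) (b ∷ y) e with a ≟F b
... | yes refl = cong (a ∷_) (hamming≡0⇒≡ x y e)

module _ {n} (C : Code n) where

  private
    _∈C? : Decidable (λ c → C c ≡ true)
    c ∈C? = C c Data.Bool.≟ true

    ⊓≡0 : ∀ m k → m ⊓ k ≡ 0 → m ≡ 0 ⊎ k ≡ 0
    ⊓≡0 zero k _ = inj₁ refl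
    ⊓≡0 (suc m) zero _ = inj₂ refl

  -- m is the junk value the fold returns when no codeword occurs in xs.
  codeword-at-0 : ∀ x m xs → m ≢ 0 → foldr _⊓_ m (L.map (hamming x) (filter _∈C? xs)) ≡ 0 →
                  Σ[ c ∈ Word n ] (C c ≡ true × hamming x c ≡ 0)
  codeword-at-0 x m [] m≢0 e = ⊥-elim (m≢0 e)
  codeword-at-0 x m (c ∷ xs) m≢0 e with c ∈C?
  ... | no _ = codeword-at-0 x m xs m≢0 e
  ... | yes c∈C with ⊓≡0 (hamming x c) _ e
  ...   | inj₁ xc≡0 = c , c∈C , xc≡0
  ...   | inj₂ rest = codeword-at-0 x m xs m≢0 rest

  fold-at-codeword : ∀ x m xs → x ∈ xs → C x ≡ true → foldr _⊓_ m (L.map (hamming x) (filter _∈C? xs)) ≡ 0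
  fold-at-codeword x m (c ∷ xs) (here refl) x∈C rewrite dec-true (c ∈C?) x∈C | hamming-refl x = refl
  fold-at-codeword x m (c ∷ xs) (there x∈xs) x∈C with c ∈C?
  ... | yes _ = trans (cong (hamming x c ⊓_) (fold-at-codeword x m xs x∈xs x∈C)) (⊓-zeroʳ (hamming x c))
  ... | no _  = fold-at-codeword x m xs x∈xs x∈C

distC≡0⇒∈ : ∀ {n} (C : Code (suc n)) x → distC C x ≡ 0 → C x ≡ true
distC≡0⇒∈ {n} C x e with codeword-at-0 C x (suc n) (allWords (suc n)) (λ ()) e
... | c , c∈C , xc≡0 = subst (λ y → C y ≡ true) (sym (hamming≡0⇒≡ x c xc≡0)) c∈C

∈⇒distC≡0 : ∀ {n} (C : Code n) x → C x ≡ true → distC C x ≡ 0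
∈⇒distC≡0 {n} C x = fold-at-codeword C x n (allWords n) (allWords-complete n x)

⟦distC≟0⟧≡χ : ∀ {n} (C : Code (suc n)) x → ⟦ distC C x ≟ 0 ⟧ ≡ χ (C x)
⟦distC≟0⟧≡χ C x with C x in x∈C
... | true  = cong χ (dec-true (distC C x ≟ 0) (∈⇒distC≡0 C x x∈C))
... | false = cong χ (dec-false (distC C x ≟ 0) (λ e → case trans (sym (distC≡0⇒∈ C x e)) x∈C of λ ()))

module _ {n} (C : Code n) (w : Word n) where

  kerDist : ℕ → ℕ
  kerDist l = sumW n (λ x → ⟦ dot w x ≟F f0 ⟧ * ⟦ distC C x ≟ l ⟧)

  nonkerDist : ℕ → ℕ
  nonkerDist l = sumW n (λ x → ⟦ ¬? (dot w x ≟F f0) ⟧ * ⟦ distC C x ≟ l ⟧)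

  kerDist+nonkerDist : ∀ l → kerDist l + nonkerDist l ≡ sumW n (λ x → ⟦ distC C x ≟ l ⟧)
  kerDist+nonkerDist l = trans (sym (sumW-+ n _ _)) (sumW-cong n split)
    where
      split : ∀ x → ⟦ dot w x ≟F f0 ⟧ * ⟦ distC C x ≟ l ⟧ + ⟦ ¬? (dot w x ≟F f0) ⟧ * ⟦ distC C x ≟ l ⟧ ≡ ⟦ distC C x ≟ l ⟧
      split x with dot w x ≟F f0
      ... | yes _ = trans (+-identityʳ _) (*-identityˡ _)
      ... | no _  = *-identityˡ _

  -- Count adjacent pairs (x, y) with w·x = 0 and y ∈ C^(l) by y first.
  kernel-neighbours : ∀ l → sumW n (λ x → ⟦ dot w x ≟F f0 ⟧ * nbrCount C x l)
                            ≡ 4 * zeros w * kerDist l + weight w * nonkerDist l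
  kernel-neighbours l = begin
    sumW n (λ x → ⟦ dot w x ≟F f0 ⟧ * nbrCount C x l)
      ≡⟨ sumW-cong n (λ x → trans (cong (⟦ dot w x ≟F f0 ⟧ *_) (nbrCount-sumW C x l)) (sym (sumW-* n ⟦ dot w x ≟F f0 ⟧ _))) ⟩
    sumW n (λ x → sumW n (λ y → ⟦ dot w x ≟F f0 ⟧ * (⟦ hamming x y ≟ 1 ⟧ * inC y)))
      ≡⟨ sumW-swap n n _ ⟩
    sumW n (λ y → sumW n (λ x → ⟦ dot w x ≟F f0 ⟧ * (⟦ hamming x y ≟ 1 ⟧ * inC y)))
      ≡⟨ sumW-cong n (λ y → trans (sumW-cong n (reorder y)) (sumW-* n (inC y) _)) ⟩
    sumW n (λ y → inC y * sumW n (λ x → ⟦ hamming y x ≟ 1 ⟧ * ⟦ dot w x ≟F f0 ⟧))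
      ≡⟨ sumW-cong n (λ y → cong (inC y *_) (adjacent-in-level n y w f0)) ⟩
    sumW n (λ y → inC y * (4 * zeros w * ⟦ dot w y ≟F f0 ⟧ + weight w * ⟦ ¬? (dot w y ≟F f0) ⟧))
      ≡⟨ sumW-cong n (λ y → distribute (inC y) (4 * zeros w) _ (weight w) _) ⟩
    sumW n (λ y → 4 * zeros w * (⟦ dot w y ≟F f0 ⟧ * inC y) + weight w * (⟦ ¬? (dot w y ≟F f0) ⟧ * inC y))
      ≡⟨ trans (sumW-+ n _ _) (cong₂ _+_ (sumW-* n (4 * zeros w) _) (sumW-* n (weight w) _)) ⟩
    4 * zeros w * kerDist l + weight w * nonkerDist l ∎
    where
      open ≡-Reasoning
      inC : Word n → ℕ
      inC y = ⟦ distC C y ≟ l ⟧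
      distribute : ∀ d z h m g → d * (z * h + m * g) ≡ z * (h * d) + m * (g * d)
      distribute = solve-∀
      rotate : ∀ h k d → h * (k * d) ≡ d * (k * h)
      rotate = solve-∀
      reorder : ∀ y x → ⟦ dot w x ≟F f0 ⟧ * (⟦ hamming x y ≟ 1 ⟧ * inC y) ≡ inC y * (⟦ hamming y x ≟ 1 ⟧ * ⟦ dot w x ≟F f0 ⟧)
      reorder y x = trans (rotate ⟦ dot w x ≟F f0 ⟧ ⟦ hamming x y ≟ 1 ⟧ (inC y)) (cong (λ h → inC y * (⟦ h ≟ 1 ⟧ * ⟦ dot w x ≟F f0 ⟧)) (hamming-sym x y))

-- Row k lists the numbers of neighbours in C^(0..3) of a vertex of C^(k); the diagonal is 52 − β_k − γ_k.
quotient : ℕ → ℕ → ℕ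
quotient 0 1 = 52
quotient 1 0 = 1
quotient 1 1 = 9
quotient 1 2 = 42
quotient 2 1 = 6
quotient 2 2 = 30
quotient 2 3 = 16
quotient 3 2 = 28
quotient 3 3 = 24
quotient _ _ = 0

sum4 : (ℕ → ℕ) → ℕ
sum4 f = f 0 + (f 1 + (f 2 + f 3))

colSum : (ℕ → ℕ) → ℕ → ℕ
colSum f l = sum4 (λ k → quotient k l * f k)

Array : Code 13 → Set
Array C = HasIntersectionArray C 3 (52 ∷ 42 ∷ 16 ∷ []) (1 ∷ 6 ∷ 28 ∷ [])

indicators-partition : ∀ d → d ≤ 3 → sum4 (λ k → ⟦ d ≟ k ⟧) ≡ 1
indicators-partition 0 _ = refl
indicators-partition 1 _ = refl
indicators-partition 2 _ = refl
indicators-partition 3 _ = refl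
indicators-partition (suc (suc (suc (suc _)))) (s≤s (s≤s (s≤s ())))

quotient-expand : ∀ d l → d ≤ 3 → quotient d l ≡ sum4 (λ k → ⟦ d ≟ k ⟧ * quotient k l)
quotient-expand (suc (suc (suc (suc _)))) l (s≤s (s≤s (s≤s ())))
quotient-expand 0 l _ = lemma (quotient 0 l) (quotient 1 l) (quotient 2 l) (quotient 3 l)
  where lemma : ∀ p q r s → p ≡ 1 * p + (0 * q + (0 * r + 0 * s))
        lemma = solve-∀
quotient-expand 1 l _ = lemma (quotient 0 l) (quotient 1 l) (quotient 2 l) (quotient 3 l)
  where lemma : ∀ p q r s → q ≡ 0 * p + (1 * q + (0 * r + 0 * s))
        lemma = solve-∀
quotient-expand 2 l _ = lemma (quotient 0 l) (quotient 1 l) (quotient 2 l) (quotient 3 l)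
  where lemma : ∀ p q r s → r ≡ 0 * p + (0 * q + (1 * r + 0 * s))
        lemma = solve-∀
quotient-expand 3 l _ = lemma (quotient 0 l) (quotient 1 l) (quotient 2 l) (quotient 3 l)
  where lemma : ∀ p q r s → s ≡ 0 * p + (0 * q + (0 * r + 1 * s))
        lemma = solve-∀

sum4-determines : ∀ (f g : ℕ → ℕ) k → k ≤ 3 → (∀ l → l ≤ 3 → l ≢ k → f l ≡ g l) → sum4 f ≡ sum4 g →
                  ∀ l → l ≤ 3 → f l ≡ g l
sum4-determines f g k k≤3 others total l l≤3 with l ≟ k
... | no l≢k = others l l≤3 l≢k
... | yes refl = remaining k k≤3 others
  where
    known-tail : ∀ {x y a b} → a ≡ b → x + a ≡ y + b → x ≡ y
    known-tail {x} {y} {a} refl e = +-cancelʳ-≡ a x y e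
    known-head : ∀ {x y a b} → a ≡ b → a + x ≡ b + y → x ≡ y
    known-head {x} {y} {a} refl e = +-cancelˡ-≡ a x y e
    remaining : ∀ k → k ≤ 3 → (∀ l → l ≤ 3 → l ≢ k → f l ≡ g l) → f k ≡ g k
    remaining (suc (suc (suc (suc _)))) (s≤s (s≤s (s≤s ()))) _
    remaining 0 _ e = known-tail (cong₂ _+_ (e 1 (s≤s z≤n) λ ()) (cong₂ _+_ (e 2 (s≤s (s≤s z≤n)) λ ()) (e 3 ≤-refl λ ()))) total
    remaining 1 _ e = known-tail (cong₂ _+_ (e 2 (s≤s (s≤s z≤n)) λ ()) (e 3 ≤-refl λ ())) (known-head (e 0 z≤n λ ()) total)
    remaining 2 _ e = known-tail (e 3 ≤-refl λ ()) (known-head (e 1 (s≤s z≤n) λ ()) (known-head (e 0 z≤n λ ()) total))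
    remaining 3 _ e = known-head (e 2 (s≤s (s≤s z≤n)) λ ()) (known-head (e 1 (s≤s z≤n) λ ()) (known-head (e 0 z≤n λ ()) total))

sumW-sum4 : ∀ n (K : ℕ → Word n → ℕ) → sumW n (λ x → sum4 (λ k → K k x)) ≡ sum4 (λ k → sumW n (K k))
sumW-sum4 n K = trans (sumW-+ n _ _) (cong (sumW n (K 0) +_) (trans (sumW-+ n _ _) (cong (sumW n (K 1) +_) (sumW-+ n (K 2) (K 3)))))

sum4-quotient-row : ∀ k → k ≤ 3 → sum4 (quotient k) ≡ 52
sum4-quotient-row 0 _ = refl
sum4-quotient-row 1 _ = refl
sum4-quotient-row 2 _ = refl
sum4-quotient-row 3 _ = refl
sum4-quotient-row (suc (suc (suc (suc _)))) (s≤s (s≤s (s≤s ())))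

module _ (C : Code 13) (H : Array C) where

  private
    covering : ∀ x → distC C x ≤ 3
    covering = proj₁ (proj₁ (proj₁ H))

    far : ∀ k l x → distC C x ≡ k → (suc l < k ⊎ suc k < l) → nbrCount C x l ≡ 0
    far = proj₂ (proj₂ (proj₁ H))

    β : ∀ i x → distC C x ≡ toℕ i → nbrCount C x (suc (toℕ i)) ≡ lookup (52 ∷ 42 ∷ 16 ∷ []) i
    β = proj₁ (proj₂ H)

    γ : ∀ i x → distC C x ≡ suc (toℕ i) → nbrCount C x (toℕ i) ≡ lookup (1 ∷ 6 ∷ 28 ∷ []) i
    γ = proj₂ (proj₂ H)

  degree : ∀ x → sum4 (nbrCount C x) ≡ 52
  degree x = begin
    sum4 (nbrCount C x)                              ≡⟨ cong₂ _+_ (nbrCount-sumW C x 0) (cong₂ _+_ (nbrCount-sumW C x 1)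
                                                          (cong₂ _+_ (nbrCount-sumW C x 2) (nbrCount-sumW C x 3))) ⟩
    sum4 (λ l → sumW 13 (λ y → adj y * ⟦ distC C y ≟ l ⟧))  ≡⟨ sumW-sum4 13 (λ l y → adj y * ⟦ distC C y ≟ l ⟧) ⟨
    sumW 13 (λ y → sum4 (λ l → adj y * ⟦ distC C y ≟ l ⟧))  ≡⟨ sumW-cong 13 in-one-class ⟩
    sumW 13 (λ y → adj y * ⟦ dot zeroW y ≟F f0 ⟧)           ≡⟨ adjacent-in-level 13 x zeroW f0 ⟩
    4 * 13 * ⟦ dot zeroW x ≟F f0 ⟧ + 0 * ⟦ ¬? (dot zeroW x ≟F f0) ⟧
                                                     ≡⟨ cong (λ d → 4 * 13 * ⟦ d ≟F f0 ⟧ + 0 * ⟦ ¬? (d ≟F f0) ⟧) (dot-zeroˡ x) ⟩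
    52                                               ∎
    where
      open ≡-Reasoning
      adj : Word 13 → ℕ
      adj y = ⟦ hamming x y ≟ 1 ⟧
      factor : ∀ a b c d e → a * b + (a * c + (a * d + a * e)) ≡ a * (b + (c + (d + e)))
      factor = solve-∀
      in-one-class : ∀ y → sum4 (λ l → adj y * ⟦ distC C y ≟ l ⟧) ≡ adj y * ⟦ dot zeroW y ≟F f0 ⟧
      in-one-class y = trans (factor (adj y) _ _ _ _) (cong (adj y *_) (trans (indicators-partition (distC C y) (covering y))
                         (cong (λ d → ⟦ d ≟F f0 ⟧) (sym (dot-zeroˡ y)))))

  off-diagonal : ∀ x k l → distC C x ≡ k → l ≤ 3 → l ≢ k → nbrCount C x l ≡ quotient k l
  off-diagonal x 0 1 e _ _ = β f0 x e
  off-diagonal x 0 2 e _ _ = far 0 2 x e (inj₂ (s≤s (s≤s z≤n)))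
  off-diagonal x 0 3 e _ _ = far 0 3 x e (inj₂ (s≤s (s≤s z≤n)))
  off-diagonal x 1 0 e _ _ = γ f0 x e
  off-diagonal x 1 2 e _ _ = β f1 x e
  off-diagonal x 1 3 e _ _ = far 1 3 x e (inj₂ (s≤s (s≤s (s≤s z≤n))))
  off-diagonal x 2 0 e _ _ = far 2 0 x e (inj₁ (s≤s (s≤s z≤n)))
  off-diagonal x 2 1 e _ _ = γ f1 x e
  off-diagonal x 2 3 e _ _ = β f2 x e
  off-diagonal x 3 0 e _ _ = far 3 0 x e (inj₁ (s≤s (s≤s z≤n)))
  off-diagonal x 3 1 e _ _ = far 3 1 x e (inj₁ (s≤s (s≤s (s≤s z≤n))))
  off-diagonal x 3 2 e _ _ = γ f2 x e
  off-diagonal x k (suc (suc (suc (suc _)))) _ (s≤s (s≤s (s≤s ()))) _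
  off-diagonal x 0 0 _ _ 0≢0 = ⊥-elim (0≢0 refl)
  off-diagonal x 1 1 _ _ 1≢1 = ⊥-elim (1≢1 refl)
  off-diagonal x 2 2 _ _ 2≢2 = ⊥-elim (2≢2 refl)
  off-diagonal x 3 3 _ _ 3≢3 = ⊥-elim (3≢3 refl)
  off-diagonal x (suc (suc (suc (suc k)))) l e _ _ = ⊥-elim (4+k≰3 (subst (_≤ 3) e (covering x)))
    where
      4+k≰3 : ¬ (suc (suc (suc (suc k))) ≤ 3)
      4+k≰3 (s≤s (s≤s (s≤s ())))

  nbrCount≡quotient : ∀ x l → l ≤ 3 → nbrCount C x l ≡ quotient (distC C x) l
  nbrCount≡quotient x = sum4-determines (nbrCount C x) (quotient (distC C x)) (distC C x) (covering x)
                          (λ l → off-diagonal x (distC C x) l refl) (trans (degree x) (sym (sum4-quotient-row (distC C x) (covering x))))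

  level-equation : ∀ w l → l ≤ 3 → colSum (kerDist C w) l ≡ 4 * zeros w * kerDist C w l + weight w * nonkerDist C w l
  level-equation w l l≤3 = trans (sym by-quotient) (kernel-neighbours C w l)
    where
      open ≡-Reasoning
      inK : Word 13 → ℕ
      inK x = ⟦ dot w x ≟F f0 ⟧
      class : ℕ → Word 13 → ℕ
      class k x = ⟦ distC C x ≟ k ⟧
      distribute : ∀ h d₀ d₁ d₂ d₃ q₀ q₁ q₂ q₃ → h * (d₀ * q₀ + (d₁ * q₁ + (d₂ * q₂ + d₃ * q₃)))
                   ≡ q₀ * (h * d₀) + (q₁ * (h * d₁) + (q₂ * (h * d₂) + q₃ * (h * d₃)))
      distribute = solve-∀
      pull : ∀ k → sumW 13 (λ x → quotient k l * (inK x * class k x)) ≡ quotient k l * kerDist C w k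
      pull k = sumW-* 13 (quotient k l) (λ x → inK x * class k x)
      by-quotient : sumW 13 (λ x → inK x * nbrCount C x l) ≡ colSum (kerDist C w) l
      by-quotient = begin
        sumW 13 (λ x → inK x * nbrCount C x l)
          ≡⟨ sumW-cong 13 (λ x → cong (inK x *_) (trans (nbrCount≡quotient x l l≤3) (quotient-expand (distC C x) l (covering x)))) ⟩
        sumW 13 (λ x → inK x * sum4 (λ k → class k x * quotient k l))
          ≡⟨ sumW-cong 13 (λ x → distribute (inK x) (class 0 x) (class 1 x) (class 2 x) (class 3 x) _ _ _ _) ⟩
        sumW 13 (λ x → sum4 (λ k → quotient k l * (inK x * class k x)))
          ≡⟨ sumW-sum4 13 (λ k x → quotient k l * (inK x * class k x)) ⟩
        sum4 (λ k → sumW 13 (λ x → quotient k l * (inK x * class k x)))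
          ≡⟨ cong₂ _+_ (pull 0) (cong₂ _+_ (pull 1) (cong₂ _+_ (pull 2) (pull 3))) ⟩
        colSum (kerDist C w) l ∎

module _ where
  open import Data.Integer using (ℤ; +_) renaming (_+_ to _+ℤ_; _*_ to _*ℤ_; _-_ to _-ℤ_)
  open import Data.Integer.Properties using (pos-+; pos-*; +-inverseʳ; i*j≡0⇒i≡0∨j≡0)
  import Data.Integer.Tactic.RingSolver as ℤ-Solver

  colSumℤ : (ℕ → ℤ) → ℕ → ℤ
  colSumℤ v l = + quotient 0 l *ℤ v 0 +ℤ (+ quotient 1 l *ℤ v 1 +ℤ (+ quotient 2 l *ℤ v 2 +ℤ + quotient 3 l *ℤ v 3))

  charPoly : ℤ → ℤ
  charPoly λ′ = (λ′ -ℤ + 52) *ℤ (λ′ -ℤ + 17) *ℤ (λ′ -ℤ + 2) *ℤ (λ′ +ℤ + 8)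

  -- Eliminating v₁, v₂, v₃ from the four eigenvector equations, a tridiagonal system, leaves charPoly λ · v₀.
  eigenvalue-root : ∀ λ′ (v : ℕ → ℤ) → (∀ l → l ≤ 3 → colSumℤ v l ≡ λ′ *ℤ v l) → charPoly λ′ *ℤ v 0 ≡ + 0
  eigenvalue-root λ′ v eigen = begin
    charPoly λ′ *ℤ v 0                             ≡⟨ certificate λ′ (v 0) (v 1) (v 2) (v 3) ⟩
    combination (D 0) (D 1) (D 2) (D 3)            ≡⟨ cong₂ (λ d₀ d₁ → combination d₀ d₁ (D 2) (D 3)) (D≡0 0 z≤n) (D≡0 1 (s≤s z≤n)) ⟩
    combination (+ 0) (+ 0) (D 2) (D 3)            ≡⟨ cong₂ (combination (+ 0) (+ 0)) (D≡0 2 (s≤s (s≤s z≤n))) (D≡0 3 ≤-refl) ⟩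
    combination (+ 0) (+ 0) (+ 0) (+ 0)            ≡⟨ vanishes λ′ ⟩
    + 0                                            ∎
    where
      open ≡-Reasoning
      q r : ℤ → ℤ
      q λ′ = (+ 30 -ℤ λ′) *ℤ (+ 24 -ℤ λ′) -ℤ + 448
      r λ′ = + 252 *ℤ (+ 24 -ℤ λ′) -ℤ q λ′ *ℤ (+ 9 -ℤ λ′)
      combination : ℤ → ℤ → ℤ → ℤ → ℤ
      combination d₀ d₁ d₂ d₃ = + 6 *ℤ (+ 24 -ℤ λ′) *ℤ d₂ -ℤ + 168 *ℤ d₃ -ℤ q λ′ *ℤ d₁ -ℤ r λ′ *ℤ d₀
      D : ℕ → ℤ
      D l = colSumℤ v l -ℤ λ′ *ℤ v l
      D≡0 : ∀ l → l ≤ 3 → D l ≡ + 0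
      D≡0 l l≤3 = trans (cong (_-ℤ λ′ *ℤ v l) (eigen l l≤3)) (+-inverseʳ (λ′ *ℤ v l))
      certificate : ∀ λ′ v₀ v₁ v₂ v₃ →
        (λ′ -ℤ + 52) *ℤ (λ′ -ℤ + 17) *ℤ (λ′ -ℤ + 2) *ℤ (λ′ +ℤ + 8) *ℤ v₀ ≡
          + 6 *ℤ (+ 24 -ℤ λ′) *ℤ ((+ 0 *ℤ v₀ +ℤ (+ 42 *ℤ v₁ +ℤ (+ 30 *ℤ v₂ +ℤ + 28 *ℤ v₃))) -ℤ λ′ *ℤ v₂)
          -ℤ + 168 *ℤ ((+ 0 *ℤ v₀ +ℤ (+ 0 *ℤ v₁ +ℤ (+ 16 *ℤ v₂ +ℤ + 24 *ℤ v₃))) -ℤ λ′ *ℤ v₃)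
          -ℤ ((+ 30 -ℤ λ′) *ℤ (+ 24 -ℤ λ′) -ℤ + 448) *ℤ ((+ 52 *ℤ v₀ +ℤ (+ 9 *ℤ v₁ +ℤ (+ 6 *ℤ v₂ +ℤ + 0 *ℤ v₃))) -ℤ λ′ *ℤ v₁)
          -ℤ (+ 252 *ℤ (+ 24 -ℤ λ′) -ℤ ((+ 30 -ℤ λ′) *ℤ (+ 24 -ℤ λ′) -ℤ + 448) *ℤ (+ 9 -ℤ λ′))
             *ℤ ((+ 0 *ℤ v₀ +ℤ (+ 1 *ℤ v₁ +ℤ (+ 0 *ℤ v₂ +ℤ + 0 *ℤ v₃))) -ℤ λ′ *ℤ v₀)
      certificate = ℤ-Solver.solve-∀
      vanishes : ∀ λ′ → + 6 *ℤ (+ 24 -ℤ λ′) *ℤ + 0 -ℤ + 168 *ℤ + 0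
                        -ℤ ((+ 30 -ℤ λ′) *ℤ (+ 24 -ℤ λ′) -ℤ + 448) *ℤ + 0
                        -ℤ (+ 252 *ℤ (+ 24 -ℤ λ′) -ℤ ((+ 30 -ℤ λ′) *ℤ (+ 24 -ℤ λ′) -ℤ + 448) *ℤ (+ 9 -ℤ λ′)) *ℤ + 0 ≡ + 0
      vanishes = ℤ-Solver.solve-∀

  +colSum : ∀ (f : ℕ → ℕ) l → + colSum f l ≡ colSumℤ (λ k → + f k) l
  +colSum f l = trans (pos-+ (q 0 * f 0) _) (cong₂ _+ℤ_ (pos-* (q 0) (f 0)) (trans (pos-+ (q 1 * f 1) _)
                (cong₂ _+ℤ_ (pos-* (q 1) (f 1)) (trans (pos-+ (q 2 * f 2) _) (cong₂ _+ℤ_ (pos-* (q 2) (f 2)) (pos-* (q 3) (f 3)))))))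
    where
      q : ℕ → ℕ
      q k = quotient k l

  +-difference : ∀ {m n k} → m + n ≡ k → + m ≡ + k -ℤ + n
  +-difference {m} {n} refl = trans (add-sub (+ m) (+ n)) (cong (_-ℤ + n) (sym (pos-+ m n)))
    where
      add-sub : ∀ a b → a ≡ (a +ℤ b) -ℤ b
      add-sub = ℤ-Solver.solve-∀

  -- With v = 5A − b the level equations say that v is an eigenvector of the quotient matrix for 52 − 5t.
  shifted-eigenvector : ∀ (A B b : ℕ → ℕ) z t → z + t ≡ 13 → (∀ l → A l + B l ≡ b l) →
                        (∀ l → l ≤ 3 → colSum b l ≡ 52 * b l) →
                        (∀ l → l ≤ 3 → colSum A l ≡ 4 * z * A l + t * B l) →
                        ∀ l → l ≤ 3 → colSumℤ (λ k → + 5 *ℤ + A k -ℤ + b k) l ≡ (+ 52 -ℤ + 5 *ℤ + t) *ℤ (+ 5 *ℤ + A l -ℤ + b l)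
  shifted-eigenvector A B b z t z+t≡13 A+B≡b b-level A-level l l≤3 = begin
    colSumℤ (λ k → + 5 *ℤ + A k -ℤ + b k) l
      ≡⟨ linear (n 0) (n 1) (n 2) (n 3) (+ A 0) (+ A 1) (+ A 2) (+ A 3) (+ b 0) (+ b 1) (+ b 2) (+ b 3) ⟩
    + 5 *ℤ colSumℤ (λ k → + A k) l -ℤ colSumℤ (λ k → + b k) l
      ≡⟨ cong₂ (λ p q → + 5 *ℤ p -ℤ q) (+colSum A l) (+colSum b l) ⟨
    + 5 *ℤ + colSum A l -ℤ + colSum b l
      ≡⟨ cong₂ (λ p q → + 5 *ℤ + p -ℤ + q) (A-level l l≤3) (b-level l l≤3) ⟩
    + 5 *ℤ + (4 * z * A l + t * B l) -ℤ + (52 * b l)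
      ≡⟨ cong₂ (λ p q → + 5 *ℤ p -ℤ q) cast (pos-* 52 (b l)) ⟩
    + 5 *ℤ (+ 4 *ℤ + z *ℤ + A l +ℤ + t *ℤ + B l) -ℤ + 52 *ℤ + b l
      ≡⟨ cong₂ (λ Z B′ → + 5 *ℤ (+ 4 *ℤ Z *ℤ + A l +ℤ + t *ℤ B′) -ℤ + 52 *ℤ + b l)
               (+-difference {z} {t} z+t≡13) (+-difference {B l} {A l} (trans (+-comm (B l) (A l)) (A+B≡b l))) ⟩
    + 5 *ℤ (+ 4 *ℤ (+ 13 -ℤ + t) *ℤ + A l +ℤ + t *ℤ (+ b l -ℤ + A l)) -ℤ + 52 *ℤ + b l
      ≡⟨ rearrange (+ t) (+ A l) (+ b l) ⟩
    (+ 52 -ℤ + 5 *ℤ + t) *ℤ (+ 5 *ℤ + A l -ℤ + b l) ∎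
    where
      open ≡-Reasoning
      n : ℕ → ℤ
      n k = + quotient k l
      linear : ∀ n₀ n₁ n₂ n₃ a₀ a₁ a₂ a₃ b₀ b₁ b₂ b₃ →
        n₀ *ℤ (+ 5 *ℤ a₀ -ℤ b₀) +ℤ (n₁ *ℤ (+ 5 *ℤ a₁ -ℤ b₁) +ℤ (n₂ *ℤ (+ 5 *ℤ a₂ -ℤ b₂) +ℤ n₃ *ℤ (+ 5 *ℤ a₃ -ℤ b₃)))
        ≡ + 5 *ℤ (n₀ *ℤ a₀ +ℤ (n₁ *ℤ a₁ +ℤ (n₂ *ℤ a₂ +ℤ n₃ *ℤ a₃))) -ℤ (n₀ *ℤ b₀ +ℤ (n₁ *ℤ b₁ +ℤ (n₂ *ℤ b₂ +ℤ n₃ *ℤ b₃)))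
      linear = ℤ-Solver.solve-∀
      cast : + (4 * z * A l + t * B l) ≡ + 4 *ℤ + z *ℤ + A l +ℤ + t *ℤ + B l
      cast = trans (pos-+ (4 * z * A l) _)
                   (cong₂ _+ℤ_ (trans (pos-* (4 * z) (A l)) (cong (_*ℤ + A l) (pos-* 4 z))) (pos-* t (B l)))
      rearrange : ∀ t a b → + 5 *ℤ (+ 4 *ℤ (+ 13 -ℤ t) *ℤ a +ℤ t *ℤ (b -ℤ a)) -ℤ + 52 *ℤ b
                            ≡ (+ 52 -ℤ + 5 *ℤ t) *ℤ (+ 5 *ℤ a -ℤ b)
      rearrange = ℤ-Solver.solve-∀

  charPoly-roots : ∀ t → t ≤ 13 → charPoly (+ 52 -ℤ + 5 *ℤ + t) ≡ + 0 → t ≡ 0 ⊎ t ≡ 7 ⊎ t ≡ 10 ⊎ t ≡ 12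
  charPoly-roots 0 _ _ = inj₁ refl
  charPoly-roots 7 _ _ = inj₂ (inj₁ refl)
  charPoly-roots 10 _ _ = inj₂ (inj₂ (inj₁ refl))
  charPoly-roots 12 _ _ = inj₂ (inj₂ (inj₂ refl))
  charPoly-roots 1 _ ()
  charPoly-roots 2 _ ()
  charPoly-roots 3 _ ()
  charPoly-roots 4 _ ()
  charPoly-roots 5 _ ()
  charPoly-roots 6 _ ()
  charPoly-roots 8 _ ()
  charPoly-roots 9 _ ()
  charPoly-roots 11 _ ()
  charPoly-roots 13 _ ()
  charPoly-roots (suc (suc (suc (suc (suc (suc (suc (suc (suc (suc (suc (suc (suc (suc _))))))))))))))
                 (s≤s (s≤s (s≤s (s≤s (s≤s (s≤s (s≤s (s≤s (s≤s (s≤s (s≤s (s≤s (s≤s ()))))))))))))) _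

  perron-eigenvector : ∀ (b : ℕ → ℕ) → (∀ l → l ≤ 3 → colSum b l ≡ 52 * b l) →
                       b 1 ≡ 52 * b 0 × b 2 ≡ 364 * b 0 × b 3 ≡ 208 * b 0
  perron-eigenvector b level = solve (b 0) (b 1) (b 2) (b 3) (level 0 z≤n) (level 1 (s≤s z≤n)) (level 3 ≤-refl)
    where
      solve : ∀ b₀ b₁ b₂ b₃ →
              0 * b₀ + (1 * b₁ + (0 * b₂ + 0 * b₃)) ≡ 52 * b₀ →
              52 * b₀ + (9 * b₁ + (6 * b₂ + 0 * b₃)) ≡ 52 * b₁ →
              0 * b₀ + (0 * b₁ + (16 * b₂ + 24 * b₃)) ≡ 52 * b₃ →
              b₁ ≡ 52 * b₀ × b₂ ≡ 364 * b₀ × b₃ ≡ 208 * b₀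
      solve b₀ b₁ b₂ b₃ row₀ row₁ row₃ = b₁≡ , b₂≡ , b₃≡
        where
          open ≡-Reasoning
          b₁≡ : b₁ ≡ 52 * b₀
          b₁≡ = trans (sym (simplify b₀ b₁ b₂ b₃)) row₀
            where
              simplify : ∀ b₀ b₁ b₂ b₃ → 0 * b₀ + (1 * b₁ + (0 * b₂ + 0 * b₃)) ≡ b₁
              simplify = solve-∀
          b₂≡ : b₂ ≡ 364 * b₀
          b₂≡ = *-cancelˡ-≡ b₂ (364 * b₀) 6 (+-cancelˡ-≡ (520 * b₀) (6 * b₂) (6 * (364 * b₀)) (begin
            520 * b₀ + 6 * b₂                                   ≡⟨ lhs b₀ b₂ b₃ ⟩
            52 * b₀ + (9 * (52 * b₀) + (6 * b₂ + 0 * b₃))       ≡⟨ subst (λ x → 52 * b₀ + (9 * x + (6 * b₂ + 0 * b₃)) ≡ 52 * x) b₁≡ row₁ ⟩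
            52 * (52 * b₀)                                      ≡⟨ rhs b₀ ⟩
            520 * b₀ + 6 * (364 * b₀)                           ∎))
            where
              lhs : ∀ b₀ b₂ b₃ → 520 * b₀ + 6 * b₂ ≡ 52 * b₀ + (9 * (52 * b₀) + (6 * b₂ + 0 * b₃))
              lhs = solve-∀
              rhs : ∀ b₀ → 52 * (52 * b₀) ≡ 520 * b₀ + 6 * (364 * b₀)
              rhs = solve-∀
          b₃≡ : b₃ ≡ 208 * b₀
          b₃≡ = sym (*-cancelˡ-≡ (208 * b₀) b₃ 28 (+-cancelˡ-≡ (24 * b₃) (28 * (208 * b₀)) (28 * b₃) (begin
            24 * b₃ + 28 * (208 * b₀)                           ≡⟨ lhs b₀ b₃ ⟩
            16 * (364 * b₀) + 24 * b₃                           ≡⟨ subst (λ x → 16 * x + 24 * b₃ ≡ 52 * b₃) b₂≡ row₃ ⟩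
            52 * b₃                                             ≡⟨ rhs b₃ ⟩
            24 * b₃ + 28 * b₃                                   ∎)))
            where
              lhs : ∀ b₀ b₃ → 24 * b₃ + 28 * (208 * b₀) ≡ 16 * (364 * b₀) + 24 * b₃
              lhs = solve-∀
              rhs : ∀ b₃ → 52 * b₃ ≡ 24 * b₃ + 28 * b₃
              rhs = solve-∀

  colSum-cong : ∀ {f g : ℕ → ℕ} → (∀ k → f k ≡ g k) → ∀ l → colSum f l ≡ colSum g l
  colSum-cong e l = cong₂ _+_ (cong (quotient 0 l *_) (e 0)) (cong₂ _+_ (cong (quotient 1 l *_) (e 1))
                    (cong₂ _+_ (cong (quotient 2 l *_) (e 2)) (cong (quotient 3 l *_) (e 3))))

  weight≤ : ∀ {n} (w : Word n) → weight w ≤ n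
  weight≤ w = subst (weight w ≤_) (zeros+weight w) (m≤n+m (weight w) (zeros w))

  module _ (C : Code 13) (H : Array C) where

    classSize : ℕ → ℕ
    classSize l = sumW 13 (λ x → ⟦ distC C x ≟ l ⟧)

    classSize-level : ∀ l → l ≤ 3 → colSum classSize l ≡ 52 * classSize l
    classSize-level l l≤3 = begin
      colSum classSize l                                   ≡⟨ colSum-cong kerDist-zeroW l ⟨
      colSum (kerDist C zeroW) l                           ≡⟨ level-equation C H zeroW l l≤3 ⟩
      4 * 13 * kerDist C zeroW l + 0 * nonkerDist C zeroW l ≡⟨ cong (λ a → 4 * 13 * a + 0) (kerDist-zeroW l) ⟩
      52 * classSize l + 0                                 ≡⟨ +-identityʳ _ ⟩
      52 * classSize l                                     ∎
      where
        open ≡-Reasoning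
        kerDist-zeroW : ∀ l → kerDist C zeroW l ≡ classSize l
        kerDist-zeroW l = sumW-cong 13 (λ x → trans (cong (λ d → ⟦ d ≟F f0 ⟧ * ⟦ distC C x ≟ l ⟧) (dot-zeroˡ x)) (*-identityˡ _))

    ∣C∣≡classSize0 : ∣ C ∣ ≡ classSize 0
    ∣C∣≡classSize0 = sumW-cong 13 (λ x → sym (⟦distC≟0⟧≡χ C x))

    ∣C∣≡5^9 : ∣ C ∣ ≡ 5 ^ 9
    ∣C∣≡5^9 = trans ∣C∣≡classSize0 (*-cancelˡ-≡ (classSize 0) (5 ^ 9) 625 (begin
      625 * classSize 0        ≡⟨ total (classSize 0) (perron-eigenvector classSize classSize-level) ⟨
      sum4 classSize           ≡⟨ sumW-sum4 13 (λ l x → ⟦ distC C x ≟ l ⟧) ⟨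
      sumW 13 (λ x → sum4 (λ l → ⟦ distC C x ≟ l ⟧)) ≡⟨ sumW-cong 13 (λ x → indicators-partition (distC C x) (covering x)) ⟩
      sumW 13 (λ _ → 1)        ≡⟨ sumW-1 13 ⟩
      5 ^ 13                   ∎))
      where
        open ≡-Reasoning
        covering : ∀ x → distC C x ≤ 3
        covering = proj₁ (proj₁ (proj₁ H))
        total : ∀ b₀ → classSize 1 ≡ 52 * b₀ × classSize 2 ≡ 364 * b₀ × classSize 3 ≡ 208 * b₀ →
                b₀ + (classSize 1 + (classSize 2 + classSize 3)) ≡ 625 * b₀
        total b₀ (e₁ , e₂ , e₃) = trans (cong₂ (λ p q → b₀ + (p + q)) e₁ (cong₂ _+_ e₂ e₃)) (sum b₀)
          where
            sum : ∀ b → b + (52 * b + (364 * b + 208 * b)) ≡ 625 * b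
            sum = solve-∀

    dual-weight : ∀ {w} → dual C w ≡ true → weight w ≡ 0 ⊎ weight w ≡ 7 ⊎ weight w ≡ 10 ⊎ weight w ≡ 12
    dual-weight {w} w∈ = charPoly-roots (weight w) (weight≤ w) (case i*j≡0⇒i≡0∨j≡0 (charPoly λ′) root of λ
                           { (inj₁ charPoly≡0) → charPoly≡0
                           ; (inj₂ v₀≡0) → ⊥-elim (v₀≢0 v₀≡0) })
      where
        λ′ : ℤ
        λ′ = + 52 -ℤ + 5 *ℤ + weight w
        v : ℕ → ℤ
        v k = + 5 *ℤ + kerDist C w k -ℤ + classSize k
        root : charPoly λ′ *ℤ v 0 ≡ + 0
        root = eigenvalue-root λ′ v (shifted-eigenvector (kerDist C w) (nonkerDist C w) classSize (zeros w) (weight w)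
                 (zeros+weight w) (kerDist+nonkerDist C w) classSize-level (level-equation C H w))
        codewords-in-kernel : kerDist C w 0 ≡ classSize 0
        codewords-in-kernel = sumW-cong 13 (λ x → ⟦⟧-absorb (distC C x ≟ 0) (dot w x ≟F f0)
                                                    (λ d≡0 → dual⇒orthogonal w∈ x (distC≡0⇒∈ C x d≡0)))
        v₀≢0 : v 0 ≢ + 0
        v₀≢0 v₀≡0 = case trans (sym (cong (λ a → + 5 *ℤ + a -ℤ + a) class₀≡5^9)) (trans (cong (λ a → + 5 *ℤ + a -ℤ + classSize 0) (sym codewords-in-kernel)) v₀≡0) of λ ()
          where
            class₀≡5^9 : classSize 0 ≡ 5 ^ 9
            class₀≡5^9 = trans (sym ∣C∣≡classSize0) ∣C∣≡5^9

∉-witness : ∀ {n} (E : Code n) {P : Word n → Set} (P? : Decidable P) {k} →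
            sumW n (λ x → ⟦ P? x ⟧) ≤ k → k < ∣ E ∣ → Σ[ x ∈ Word n ] (E x ≡ true × ¬ P x)
∉-witness {n} E {P} P? {k} ∣P∣≤k k<∣E∣ = extract (sumW-≢0⇒ n outside outside≢0)
  where
    outside : Word n → ℕ
    outside x = χ (E x) * ⟦ ¬? (P? x) ⟧
    cover : ∀ x → χ (E x) ≤ outside x + ⟦ P? x ⟧
    cover x with E x | P? x
    ... | false | _     = z≤n
    ... | true  | yes _ = s≤s z≤n
    ... | true  | no _  = s≤s z≤n
    outside≢0 : sumW n outside ≢ 0
    outside≢0 e = <-irrefl refl (≤-<-trans ∣P∣≤k (<-≤-trans k<∣E∣ (begin
      ∣ E ∣                                          ≤⟨ sumW-mono n cover ⟩
      sumW n (λ x → outside x + ⟦ P? x ⟧)            ≡⟨ sumW-+ n outside _ ⟩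
      sumW n outside + sumW n (λ x → ⟦ P? x ⟧)       ≡⟨ cong (_+ _) e ⟩
      sumW n (λ x → ⟦ P? x ⟧)                        ∎)))
      where open ≤-Reasoning
    extract : Σ[ x ∈ Word n ] outside x ≢ 0 → Σ[ x ∈ Word n ] (E x ≡ true × ¬ P x)
    extract (x , p) with E x in x∈E | P? x
    ... | true  | no ¬Px = x , x∈E , ¬Px
    ... | true  | yes _  = ⊥-elim (p refl)
    ... | false | _      = ⊥-elim (p refl)

InSpan : ∀ {n} → Word n → Word n → Set
InSpan w x = Σ[ c ∈ F5 ] x ≡ c · w

inSpan? : ∀ {n} (w : Word n) → Decidable (InSpan w)
inSpan? w x = any? (λ c → x ≟W (c · w))

span-size : ∀ {n} (w : Word n) → sumW n (λ x → ⟦ inSpan? w x ⟧) ≤ 5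
span-size {n} w = begin
  sumW n (λ x → ⟦ inSpan? w x ⟧)                    ≤⟨ sumW-mono n some-multiple ⟩
  sumW n (λ x → sum₅ (λ c → ⟦ x ≟W (c · w) ⟧))      ≡⟨ sumW-sum₅ n (λ c x → ⟦ x ≟W (c · w) ⟧) ⟩
  sum₅ (λ c → sumW n (λ x → ⟦ x ≟W (c · w) ⟧))      ≡⟨ sum₅-cong (λ c → sumW-δ n (c · w)) ⟩
  5                                                 ∎
  where
    open ≤-Reasoning
    some-multiple : ∀ x → ⟦ inSpan? w x ⟧ ≤ sum₅ (λ c → ⟦ x ≟W (c · w) ⟧)
    some-multiple x = ⟦⟧≤ (inSpan? w x) (λ (c , x≡cw) → ≤-trans (≤-reflexive (sym (cong χ (dec-true (x ≟W (c · w)) x≡cw))))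
                                                                 (sum₅-≥ (λ c → ⟦ x ≟W (c · w) ⟧) c))

commonZeros : ∀ {n} → Word n → Word n → ℕ
commonZeros [] [] = 0
commonZeros (a ∷ u) (b ∷ v) = ⟦ a ≟F f0 ⟧ * ⟦ b ≟F f0 ⟧ + commonZeros u v

commonZeros≤zeros : ∀ {n} a b (u v : Word n) → commonZeros u v ≤ zeros ((a · u) ⊕ (b · v))
commonZeros≤zeros a b [] [] = z≤n
commonZeros≤zeros a b (x ∷ u) (y ∷ v) = +-mono-≤ (local a b x y) (commonZeros≤zeros a b u v)
  where
    local : ∀ a b x y → ⟦ x ≟F f0 ⟧ * ⟦ y ≟F f0 ⟧ ≤ ⟦ ((a *₅ x) +₅ (b *₅ y)) ≟F f0 ⟧
    local = from-yes (all? λ a → all? λ b → all? λ x → all? λ y →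
              (⟦ x ≟F f0 ⟧ * ⟦ y ≟F f0 ⟧) ≤? ⟦ ((a *₅ x) +₅ (b *₅ y)) ≟F f0 ⟧)

-- Zero counts of representatives of the six points of the projective line spanned by u and v.
projectiveZeros : ∀ {n} → Word n → Word n → ℕ
projectiveZeros u v = zeros (comb f1 f0) + (zeros (comb f0 f1) + (zeros (comb f1 f1) +
                      (zeros (comb f2 f1) + (zeros (comb f3 f1) + zeros (comb f4 f1)))))
  where
    comb : F5 → F5 → Word _
    comb a b = (a · u) ⊕ (b · v)

-- A coordinate where u and v do not both vanish is killed by exactly one of the six points.
projectiveZeros≡ : ∀ {n} (u v : Word n) → projectiveZeros u v ≡ 5 * commonZeros u v + n
projectiveZeros≡ [] [] = refl
projectiveZeros≡ {suc n} (x ∷ u) (y ∷ v) =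
  trans (interleave (z f1 f0) (z f0 f1) (z f1 f1) (z f2 f1) (z f3 f1) (z f4 f1) _ _ _ _ _ _)
        (trans (cong₂ _+_ (local x y) (projectiveZeros≡ u v)) (collect (⟦ x ≟F f0 ⟧ * ⟦ y ≟F f0 ⟧) (commonZeros u v) n))
  where
    z : F5 → F5 → ℕ
    z a b = ⟦ ((a *₅ x) +₅ (b *₅ y)) ≟F f0 ⟧
    local : ∀ x y → let z = λ a b → ⟦ ((a *₅ x) +₅ (b *₅ y)) ≟F f0 ⟧ in
            z f1 f0 + (z f0 f1 + (z f1 f1 + (z f2 f1 + (z f3 f1 + z f4 f1)))) ≡ 5 * (⟦ x ≟F f0 ⟧ * ⟦ y ≟F f0 ⟧) + 1
    local = from-yes (all? λ x → all? λ y → let z = λ a b → ⟦ ((a *₅ x) +₅ (b *₅ y)) ≟F f0 ⟧ in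
              (z f1 f0 + (z f0 f1 + (z f1 f1 + (z f2 f1 + (z f3 f1 + z f4 f1))))) ≟ (5 * (⟦ x ≟F f0 ⟧ * ⟦ y ≟F f0 ⟧) + 1))
    interleave : ∀ a b c d e f A B C D E F → (a + A) + ((b + B) + ((c + C) + ((d + D) + ((e + E) + (f + F)))))
                 ≡ (a + (b + (c + (d + (e + f))))) + (A + (B + (C + (D + (E + F)))))
    interleave = solve-∀
    collect : ∀ p q n → (5 * p + 1) + (5 * q + n) ≡ 5 * (p + q) + suc n
    collect = solve-∀

one·⊕zero· : ∀ {n} (u v : Word n) → (f1 · u) ⊕ (f0 · v) ≡ u
one·⊕zero· [] [] = refl
one·⊕zero· (x ∷ u) (y ∷ v) = cong₂ _∷_ (from-yes (all? λ x → all? λ y → ((f1 *₅ x) +₅ (f0 *₅ y)) ≟F x) x y) (one·⊕zero· u v)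

·⊕≡zero⇒inSpan : ∀ {n} a (u v : Word n) → (a · u) ⊕ (f1 · v) ≡ zeroW → InSpan u v
·⊕≡zero⇒inSpan a u v e = f4 *₅ a , coordinates u v e
  where
    coordinates : ∀ {n} (u v : Word n) → (a · u) ⊕ (f1 · v) ≡ zeroW → v ≡ (f4 *₅ a) · u
    coordinates [] [] _ = refl
    coordinates (x ∷ u) (y ∷ v) e = cong₂ _∷_ (local a x y (cong head e)) (coordinates u v (cong tail e))
      where
        local : ∀ a x y → (a *₅ x) +₅ (f1 *₅ y) ≡ f0 → y ≡ (f4 *₅ a) *₅ x
        local = from-yes (all? λ a → all? λ x → all? λ y → (((a *₅ x) +₅ (f1 *₅ y)) ≟F f0) →-dec (y ≟F ((f4 *₅ a) *₅ x)))

-- 13 − t for the nonzero dual weights t = 12, 10, 7.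
zeroCount : Fin 3 → ℕ
zeroCount f0 = 1
zeroCount f1 = 3
zeroCount f2 = 6

ZeroCount : ℕ → Set
ZeroCount z = Σ[ i ∈ Fin 3 ] zeroCount i ≡ z

Fits : ℕ → ℕ → ℕ → ℕ → ℕ → ℕ → ℕ → Set
Fits k z₀ z₁ z₂ z₃ z₄ z₅ = 2 ≤ k × k ≤ z₀ × k ≤ z₁ × k ≤ z₂ × k ≤ z₃ × k ≤ z₄ × k ≤ z₅ ×
                           z₀ + (z₁ + (z₂ + (z₃ + (z₄ + z₅)))) ≡ 5 * k + 13

no-fits : ∀ k z₀ z₁ z₂ z₃ z₄ z₅ → ZeroCount z₀ → ZeroCount z₁ → ZeroCount z₂ → ZeroCount z₃ → ZeroCount z₄ → ZeroCount z₅ →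
          ¬ Fits k z₀ z₁ z₂ z₃ z₄ z₅
no-fits k _ _ _ _ _ _ (i₀ , refl) (i₁ , refl) (i₂ , refl) (i₃ , refl) (i₄ , refl) (i₅ , refl) fits@(_ , k≤z₀ , _) =
  by-enumeration (fromℕ< k<7) i₀ i₁ i₂ i₃ i₄ i₅ (subst (λ k → Fits k _ _ _ _ _ _) (sym (toℕ-fromℕ< k<7)) fits)
  where
    zeroCount≤6 : ∀ i → zeroCount i ≤ 6
    zeroCount≤6 f0 = s≤s z≤n
    zeroCount≤6 f1 = s≤s (s≤s (s≤s z≤n))
    zeroCount≤6 f2 = ≤-refl
    k<7 : k < 7
    k<7 = s≤s (≤-trans k≤z₀ (zeroCount≤6 i₀))
    by-enumeration : ∀ (k : Fin 7) i₀ i₁ i₂ i₃ i₄ i₅ →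
                     ¬ Fits (toℕ k) (zeroCount i₀) (zeroCount i₁) (zeroCount i₂) (zeroCount i₃) (zeroCount i₄) (zeroCount i₅)
    by-enumeration = from-yes (all? λ (k : Fin 7) → all? λ (i₀ : Fin 3) → all? λ (i₁ : Fin 3) → all? λ (i₂ : Fin 3) →
      all? λ (i₃ : Fin 3) → all? λ (i₄ : Fin 3) → all? λ (i₅ : Fin 3) →
      let z = zeroCount in
      ¬? ((2 ≤? toℕ k) ×-dec (toℕ k ≤? z i₀) ×-dec (toℕ k ≤? z i₁) ×-dec (toℕ k ≤? z i₂) ×-dec (toℕ k ≤? z i₃)
          ×-dec (toℕ k ≤? z i₄) ×-dec (toℕ k ≤? z i₅) ×-dec ((z i₀ + (z i₁ + (z i₂ + (z i₃ + (z i₄ + z i₅))))) ≟ (5 * toℕ k + 13))))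

zeros-complement : ∀ {n t z} (u : Word n) → weight u ≡ t → z + t ≡ n → z ≡ zeros u
zeros-complement u refl e = +-cancelʳ-≡ (weight u) _ _ (trans e (sym (zeros+weight u)))

zeroCount-of-weight : ∀ (u : Word 13) → u ≢ zeroW → weight u ≡ 0 ⊎ weight u ≡ 7 ⊎ weight u ≡ 10 ⊎ weight u ≡ 12 →
                      ZeroCount (zeros u)
zeroCount-of-weight u u≢0 (inj₁ wt≡0)              = ⊥-elim (u≢0 (weight≡0⇒≡zeroW u wt≡0))
zeroCount-of-weight u _   (inj₂ (inj₁ wt≡7))        = f2 , zeros-complement u wt≡7 refl
zeroCount-of-weight u _   (inj₂ (inj₂ (inj₁ wt≡10))) = f1 , zeros-complement u wt≡10 refl
zeroCount-of-weight u _   (inj₂ (inj₂ (inj₂ wt≡12))) = f0 , zeros-complement u wt≡12 refl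

first-two-zero : ∀ {n} (u : Word (suc (suc n))) → dot (f1 ∷ zeroW) u ≡ f0 → dot (f0 ∷ f1 ∷ zeroW) u ≡ f0 →
                 head u ≡ f0 × head (tail u) ≡ f0
first-two-zero (p ∷ q ∷ r) e₀ e₁ rewrite dot-zeroˡ r = pick₀ p q e₀ , pick₁ p q e₁
  where
    pick₀ : ∀ p q → (f1 *₅ p) +₅ ((f0 *₅ q) +₅ f0) ≡ f0 → p ≡ f0
    pick₀ = from-yes (all? λ p → all? λ q → (((f1 *₅ p) +₅ ((f0 *₅ q) +₅ f0)) ≟F f0) →-dec (p ≟F f0))
    pick₁ : ∀ p q → (f0 *₅ p) +₅ ((f1 *₅ q) +₅ f0) ≡ f0 → q ≡ f0
    pick₁ = from-yes (all? λ p → all? λ q → (((f0 *₅ p) +₅ ((f1 *₅ q) +₅ f0)) ≟F f0) →-dec (q ≟F f0))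

2≤commonZeros : ∀ {n} (u v : Word (suc (suc n))) → head u ≡ f0 × head (tail u) ≡ f0 → head v ≡ f0 × head (tail v) ≡ f0 →
                2 ≤ commonZeros u v
2≤commonZeros (.f0 ∷ .f0 ∷ _) (.f0 ∷ .f0 ∷ _) (refl , refl) (refl , refl) = s≤s (s≤s z≤n)

module DualSubcode (C : Code 13) (lin : IsLinear C) (H : Array C) where

  D : Code 13
  D = dual C

  e₀ e₁ : Word 13
  e₀ = f1 ∷ zeroW
  e₁ = f0 ∷ f1 ∷ zeroW

  E : Code 13
  E = (D ∩⊥ e₀) ∩⊥ e₁

  625≤∣D∣ : 625 ≤ ∣ D ∣
  625≤∣D∣ = *-cancelˡ-≤ {625} {∣ D ∣} (5 ^ 9) (subst (λ c → 5 ^ 13 ≤ c * ∣ D ∣) (∣C∣≡5^9 C H) (dual-size lin))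

  25≤∣E∣ : 25 ≤ ∣ E ∣
  25≤∣E∣ = *-cancelˡ-≤ {25} {∣ E ∣} 25 (begin
    25 * 25               ≤⟨ 625≤∣D∣ ⟩
    ∣ D ∣                 ≤⟨ section-size-≥ D e₀ dual-linear ⟩
    5 * ∣ D ∩⊥ e₀ ∣       ≤⟨ *-monoʳ-≤ 5 (section-size-≥ (D ∩⊥ e₀) e₁ (∩⊥-linear dual-linear e₀)) ⟩
    5 * (5 * ∣ E ∣)       ≡⟨ *-assoc 5 5 (∣ E ∣) ⟨
    25 * ∣ E ∣            ∎)
    where open ≤-Reasoning

  E⊆D : ∀ {u} → E u ≡ true → D u ≡ true
  E⊆D {u} u∈E = ∩⊥⇒∈ {E = D} {v = e₀} (∩⊥⇒∈ {E = D ∩⊥ e₀} {v = e₁} u∈E)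

  E-vanishes-on-first-two : ∀ {u} → E u ≡ true → head u ≡ f0 × head (tail u) ≡ f0
  E-vanishes-on-first-two {u} u∈E =
    first-two-zero u (∩⊥⇒⊥ {E = D} {v = e₀} (∩⊥⇒∈ {E = D ∩⊥ e₀} {v = e₁} u∈E)) (∩⊥⇒⊥ {E = D ∩⊥ e₀} {v = e₁} u∈E)

  zeroCount-of-dual : ∀ {u} → D u ≡ true → u ≢ zeroW → ZeroCount (zeros u)
  zeroCount-of-dual {u} u∈D u≢0 = zeroCount-of-weight u u≢0 (dual-weight C H u∈D)

  -- The six points a·w₁ + b·w₂ of the projective line spanned by w₁ and w₂ are nonzero dual codewords, so each
  -- has 1, 3 or 6 zeros, while all of them vanish on the at least two common zeros of w₁ and w₂.
  no-independent-pair : ∀ {w₁ w₂} → E w₁ ≡ true → w₁ ≢ zeroW → E w₂ ≡ true → ¬ InSpan w₁ w₂ → ⊥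
  no-independent-pair {w₁} {w₂} w₁∈E w₁≢0 w₂∈E w₂∉span =
    no-fits (commonZeros w₁ w₂) _ _ _ _ _ _
      (zc f1 f0 (λ e → w₁≢0 (trans (sym (one·⊕zero· w₁ w₂)) e)))
      (zc f0 f1 (nonzero f0)) (zc f1 f1 (nonzero f1)) (zc f2 f1 (nonzero f2)) (zc f3 f1 (nonzero f3)) (zc f4 f1 (nonzero f4))
      ( 2≤commonZeros w₁ w₂ (E-vanishes-on-first-two w₁∈E) (E-vanishes-on-first-two w₂∈E)
      , commonZeros≤zeros f1 f0 w₁ w₂ , commonZeros≤zeros f0 f1 w₁ w₂ , commonZeros≤zeros f1 f1 w₁ w₂
      , commonZeros≤zeros f2 f1 w₁ w₂ , commonZeros≤zeros f3 f1 w₁ w₂ , commonZeros≤zeros f4 f1 w₁ w₂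
      , projectiveZeros≡ w₁ w₂ )
    where
      D-linear : IsLinear D
      D-linear = dual-linear
      ⊕-closed = proj₁ (proj₂ D-linear)
      ·-closed = proj₂ (proj₂ D-linear)
      zc : ∀ a b → (a · w₁) ⊕ (b · w₂) ≢ zeroW → ZeroCount (zeros ((a · w₁) ⊕ (b · w₂)))
      zc a b = zeroCount-of-dual (⊕-closed (a · w₁) (b · w₂) (·-closed a w₁ (E⊆D w₁∈E)) (·-closed b w₂ (E⊆D w₂∈E)))
      nonzero : ∀ a → (a · w₁) ⊕ (f1 · w₂) ≢ zeroW
      nonzero a e = w₂∉span (·⊕≡zero⇒inSpan a w₁ w₂ e)

  1<∣E∣ : 1 < ∣ E ∣
  1<∣E∣ = ≤-trans (s≤s (s≤s z≤n)) 25≤∣E∣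

  5<∣E∣ : 5 < ∣ E ∣
  5<∣E∣ = ≤-trans (s≤s (s≤s (s≤s (s≤s (s≤s (s≤s z≤n)))))) 25≤∣E∣

corollary4 : ¬ (Σ (Code 13) (λ C → IsLinear C × HasIntersectionArray C 3 (52 ∷ 42 ∷ 16 ∷ []) (1 ∷ 6 ∷ 28 ∷ [])))
corollary4 (C , lin , H) =
  case ∉-witness E (_≟W zeroW) (≤-reflexive (sumW-δ 13 zeroW)) 1<∣E∣ of λ (w₁ , w₁∈E , w₁≢0) →
  case ∉-witness E (inSpan? w₁) (span-size w₁) 5<∣E∣ of λ (w₂ , w₂∈E , w₂∉span) →
  no-independent-pair w₁∈E w₁≢0 w₂∈E w₂∉span
  where open DualSubcode C lin H
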